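{- Let $D$ be a squarefree positive integer with $D\equiv 2,3\pmod 4$, and suppose $\sqrt D=[k;\overline{u,\dots,u,2k}]$ with positive integers $k>u\geq 5$, where the period consists of $\ell$ entries equal to $u$ followed by $2k$. Let $p_h/q_h$ ($h\geq 0$) be the convergents of $\sqrt D$ and $\alpha_h=p_h+q_h\sqrt D$. Let $i<j$ be odd positive integers with $j\leq(\ell-4)/2$. Then there is no integer $h\geq 0$ such that $\alpha_i\alpha_j\succ\alpha_h^2$.
   Context: For $\beta=x+y\sqrt D$ ($x,y\in\mathbb{Q}$), $\beta'=x-y\sqrt D$; $\beta$ is totally positive if $\beta>0$ and $\beta'>0$ (with $\sqrt D>0$); $\beta\succ\gamma$ means $\beta-\gamma$ is totally positive. Convergents: $p_{ -1}=1,q_{ -1}=0,p_0=k,q_0=1$, $p_{h+1}=a_{h+1}p_h+p_{h-1}$, $q_{h+1}=a_{h+1}q_h+q_{h-1}$, with $a_0,a_1,\dots$ the partial quotients of $\sqrt D$. -}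

module Defs where

open import Data.Nat as ℕ using (ℕ; zero; suc; _+_; _*_; _∸_; _≤_; _<_; _≡ᵇ_)
open import Data.Nat.Divisibility using (_∣_)
open import Data.Nat.DivMod using (_/_; _%_)
open import Data.Integer as ℤ using (ℤ; +_)
open import Data.Product using (_×_; _,_; proj₁; proj₂)
open import Data.Bool using (if_then_else_)
open import Relation.Nullary using (does)
open import Relation.Binary.PropositionalEquality using (_≡_)

Squarefree : ℕ → Set
Squarefree D = ∀ p → p * p ∣ D → p ≡ 1

floorSqrt : ℕ → ℕ
floorSqrt zero = zero
floorSqrt (suc n) =
  let r = floorSqrt n in
  if does (suc r * suc r ℕ.≤? suc n) then suc r else r

-- division returning 0 on divisor 0 (never used with divisor 0 for non-square D)
_div_ : ℕ → ℕ → ℕ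
n div zero = zero
n div (suc d) = n / suc d

-- Standard continued-fraction algorithm for √D:
--   m₀ = 0, d₀ = 1, a₀ = ⌊√D⌋,
--   m_{n+1} = d_n a_n − m_n, d_{n+1} = (D − m_{n+1}²)/d_n,
--   a_{n+1} = ⌊(a₀ + m_{n+1}) / d_{n+1}⌋.
-- cfState D n = (m_n , d_n , a_n)
cfState : ℕ → ℕ → ℕ × ℕ × ℕ
cfState D zero = 0 , 1 , floorSqrt D
cfState D (suc n) with cfState D n
... | m , d , a =
  let m' = d * a ∸ m
      d' = (D ∸ m' * m') div d
  in m' , d' , ((floorSqrt D + m') div d')

cfSqrt : ℕ → ℕ → ℕ
cfSqrt D n = proj₂ (proj₂ (cfState D n))

-- The periodic sequence [k; u, …, u (ℓ times), 2k, u, …, u, 2k, …]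
periodSeq : ℕ → ℕ → ℕ → ℕ → ℕ
periodSeq k u ℓ zero = k
periodSeq k u ℓ (suc n) =
  if does ((n % suc ℓ) ℕ.<? ℓ) then u else 2 * k

-- Convergents of a sequence of partial quotients a:
-- pqPair a h = ((p_{h-1}, p_h), (q_{h-1}, q_h)) with p_{-1}=1, q_{-1}=0, p_0=a_0, q_0=1.
pqPair : (ℕ → ℕ) → ℕ → (ℕ × ℕ) × (ℕ × ℕ)
pqPair a zero = (1 , a 0) , (0 , 1)
pqPair a (suc h) with pqPair a h
... | (p₋ , p) , (q₋ , q) = (p , a (suc h) * p + p₋) , (q , a (suc h) * q + q₋)

conv-p : (ℕ → ℕ) → ℕ → ℕ
conv-p a h = proj₂ (proj₁ (pqPair a h))

conv-q : (ℕ → ℕ) → ℕ → ℕ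
conv-q a h = proj₂ (proj₂ (pqPair a h))

-- Elements x + y√D of ℤ[√D], represented by (x , y).
ZD : Set
ZD = ℤ × ℤ

mulD : ℕ → ZD → ZD → ZD
mulD D (x , y) (x' , y') = (x ℤ.* x' ℤ.+ (+ D) ℤ.* y ℤ.* y') , (x ℤ.* y' ℤ.+ y ℤ.* x')

subD : ZD → ZD → ZD
subD (x , y) (x' , y') = (x ℤ.- x') , (y ℤ.- y')

-- x + y√D is totally positive  ⇔  x + y√D > 0 and x − y√D > 0
--                               ⇔  x > 0 and x² > D y².
TotallyPositive : ℕ → ZD → Set
TotallyPositive D (x , y) = (ℤ.0ℤ ℤ.< x) × ((+ D) ℤ.* y ℤ.* y ℤ.< x ℤ.* x)

_≻[_]_ : ZD → ℕ → ZD → Set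
β ≻[ D ] γ = TotallyPositive D (subD β γ)

alpha : ℕ → ℕ → ZD
alpha D h = (+ conv-p (cfSqrt D) h) , (+ conv-q (cfSqrt D) h)

-- Write G_r for the u-Fibonacci numbers (G_0 = 0, G_1 = 1, G_{r+2} = u G_{r+1} + G_r).
-- While the partial quotients equal u, the convergents α_n = p_n + q_n √D and their
-- conjugates α′_n satisfy x_{n+2} = u x_{n+1} + x_n, hence Catalan's identity
--   α_a α_{a+2r} − α_{a+r}² = (−1)^a G_r² (α_0 α_2 − α_1²).
-- Let m = (i + j) / 2 = i + r.  If h ≥ m, the rational part of α_i α_j − α_h² is at
-- most that of α_i α_j − α_m², which is −G_r² (k² − u k − 1 + D) ≤ 0.  If h < m, look
-- at the real numbers α′_n: their signs alternate, because p_n² − D q_n² = (−1)^(n+1) d_{n+1}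
-- in the continued fraction algorithm, and |α′_n| = u |α′_{n+1}| + |α′_{n+2}|, so
-- α′_h² > u² α′_m².  With the Catalan identities at (i, r) and (i − 1, r + 1) this gives
-- u² G_{r+1}² < G_r² + G_{r+1}², which is false.  These comparisons take place in the
-- real ordering of ℤ[√D], available because √D is irrational.

module Submission where

open import Defs
open import Data.Nat.Base as ℕ using (ℕ; zero; suc; z≤n; s≤s; _≤′_; ≤′-refl; ≤′-step)
import Data.Nat.Properties as ℕₚ
open import Data.Nat.Induction using (<-rec)
open import Data.Nat.DivMod using (_/_; _%_; m/n*n≤m; m≡m%n+[m/n]*n; m%n<n; m*[n/m]≡n; m<n⇒m%n≡m)
open import Data.Nat.Divisibility using (_∣_; divides; ∣m+n∣m⇒∣n; ∣m∣n⇒∣m+n; ∣n⇒∣m*n; m∣m*n; 1∣_)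
import Data.Nat.Tactic.RingSolver as ℕ-Solver
open import Data.Integer.Base as ℤ
  using (ℤ; +_; +[1+_]; -[1+_]; 0ℤ; 1ℤ; -1ℤ; _^_; ∣_∣; +<+; +≤+; positive; nonNegative; >-nonZero)
import Data.Integer.Properties as ℤₚ
import Data.Integer.Tactic.RingSolver as ℤ-Solver
open import Data.Product using (_×_; _,_; proj₁; proj₂; ∃; ∃₂)
open import Data.Sum using (_⊎_; inj₁; inj₂)
open import Data.Empty using (⊥-elim)
open import Data.Bool.Base using (true; false; if_then_else_)
open import Function using (_∘_)
open import Relation.Nullary using (¬_; Dec; yes; no; does)
open import Relation.Binary.Definitions using (tri<; tri≈; tri>)
open import Relation.Binary.PropositionalEquality

cong₃ : ∀ {A B C E : Set} (f : A → B → C → E) {x x′ y y′ z z′} → x ≡ x′ → y ≡ y′ → z ≡ z′ → f x y z ≡ f x′ y′ z′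
cong₃ f refl refl refl = refl

module _ where

  open import Data.Integer.Base using (_+_; _-_; _*_; -_; _≤_; _<_)
  open ℤ-Solver using (solve-∀)

  i<j⇒0<j-i : ∀ {i j} → i < j → 0ℤ < j - i
  i<j⇒0<j-i {i} {j} i<j = subst (_< j - i) (ℤₚ.+-inverseʳ i) (ℤₚ.+-monoˡ-< (- i) i<j)

  0<j-i⇒i<j : ∀ {i j} → 0ℤ < j - i → i < j
  0<j-i⇒i<j {i} {j} 0<j-i = subst₂ _<_ (ℤₚ.+-identityˡ i) (j-i+i≡j i j) (ℤₚ.+-monoˡ-< i 0<j-i)
    where
    j-i+i≡j : ∀ i j → j - i + i ≡ j
    j-i+i≡j = solve-∀

  0≤i*i : ∀ i → 0ℤ ≤ i * i
  0≤i*i (+ n)    = subst (0ℤ ≤_) (ℤₚ.pos-* n n) (+≤+ z≤n)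
  0≤i*i -[1+ n ] = +≤+ z≤n

  0<i*j : ∀ {i j} → 0ℤ < i → 0ℤ < j → 0ℤ < i * j
  0<i*j {+[1+ m ]} {+[1+ n ]} _ _ = +<+ (s≤s z≤n)
  0<i*j {+ zero} (+<+ ())
  0<i*j {+[1+ m ]} {+ zero} _ (+<+ ())

  0≤i*j : ∀ {i j} → 0ℤ ≤ i → 0ℤ ≤ j → 0ℤ ≤ i * j
  0≤i*j {+ m} {+ n} _ _ = subst (0ℤ ≤_) (ℤₚ.pos-* m n) (+≤+ z≤n)

  *-mono-<-nonNeg : ∀ {i j k l} → 0ℤ ≤ i → i < j → 0ℤ ≤ k → k < l → i * k < j * l
  *-mono-<-nonNeg {i} {j} {k} {l} 0≤i i<j 0≤k k<l = begin-strict
    i * k ≤⟨ ℤₚ.*-monoˡ-≤-nonNeg i {{nonNegative 0≤i}} (ℤₚ.<⇒≤ k<l) ⟩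
    i * l <⟨ ℤₚ.*-monoʳ-<-pos l {{positive (ℤₚ.≤-<-trans 0≤k k<l)}} i<j ⟩
    j * l ∎
    where open ℤₚ.≤-Reasoning

  *-self-mono-≤ : ∀ {i j} → 0ℤ ≤ i → i ≤ j → i * i ≤ j * j
  *-self-mono-≤ {i} {j} 0≤i i≤j = begin
    i * i ≤⟨ ℤₚ.*-monoˡ-≤-nonNeg i {{nonNegative 0≤i}} i≤j ⟩
    i * j ≤⟨ ℤₚ.*-monoʳ-≤-nonNeg j {{nonNegative (ℤₚ.≤-trans 0≤i i≤j)}} i≤j ⟩
    j * j ∎
    where open ℤₚ.≤-Reasoning

  i*i<j*j⇒i<j : ∀ {i j} → 0ℤ ≤ j → i * i < j * j → i < j
  i*i<j*j⇒i<j {i} {j} 0≤j i*i<j*j with ℤₚ.≤-total j i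
  ... | inj₁ j≤i = ⊥-elim (ℤₚ.<⇒≱ i*i<j*j (*-self-mono-≤ 0≤j j≤i))
  ... | inj₂ i≤j = ℤₚ.≤∧≢⇒< i≤j λ { refl → ℤₚ.<-irrefl refl i*i<j*j }

module _ where

  open import Data.Integer.Base using (_*_)

  -1^-cases : ∀ n → -1ℤ ^ n ≡ 1ℤ ⊎ -1ℤ ^ n ≡ -1ℤ
  -1^-cases zero = inj₁ refl
  -1^-cases (suc n) with -1^-cases n
  ... | inj₁ e = inj₂ (cong (-1ℤ *_) e)
  ... | inj₂ e = inj₁ (cong (-1ℤ *_) e)

  -1^even : ∀ t → -1ℤ ^ (t ℕ.* 2) ≡ 1ℤ
  -1^even zero    = refl
  -1^even (suc t) = cong (λ s → -1ℤ * (-1ℤ * s)) (-1^even t)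

  -1^odd : ∀ t → -1ℤ ^ suc (t ℕ.* 2) ≡ -1ℤ
  -1^odd t = cong (-1ℤ *_) (-1^even t)

module QuadraticIntegers (D : ℕ) where

  open import Data.Integer.Base using (_+_; _-_; _*_; -_; _≤_; _<_)
  open ℤ-Solver using (solve-∀)

  infixl 6 _+ᴰ_ _-ᴰ_
  infixl 7 _*ᴰ_ _·_
  infix 8 -ᴰ_ √D·_

  _+ᴰ_ : ZD → ZD → ZD
  (a , b) +ᴰ (c , d) = a + c , b + d

  -ᴰ_ : ZD → ZD
  -ᴰ (a , b) = - a , - b

  _-ᴰ_ : ZD → ZD → ZD
  _-ᴰ_ = subD

  _*ᴰ_ : ZD → ZD → ZD
  _*ᴰ_ = mulD D

  _·_ : ℤ → ZD → ZD
  n · (a , b) = n * a , n * b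

  conj : ZD → ZD
  conj (a , b) = a , - b

  √D·_ : ZD → ZD
  √D· (a , b) = + D * b , a

  0ᴰ : ZD
  0ᴰ = 0ℤ , 0ℤ

  norm : ZD → ℤ
  norm (a , b) = a * a - + D * b * b

  norm-* : ∀ β γ → norm (β *ᴰ γ) ≡ norm β * norm γ
  norm-* (a , b) (c , d) = e a b c d (+ D)
    where
    e : ∀ a b c d D → (a * c + D * b * d) * (a * c + D * b * d) - D * (a * d + b * c) * (a * d + b * c)
                     ≡ (a * a - D * b * b) * (c * c - D * d * d)
    e = solve-∀

  +ᴰ-comm : ∀ β γ → β +ᴰ γ ≡ γ +ᴰ β
  +ᴰ-comm (a , b) (c , d) = cong₂ _,_ (ℤₚ.+-comm a c) (ℤₚ.+-comm b d)

  neg-unique : ∀ β γ → β +ᴰ γ ≡ 0ᴰ → γ ≡ -ᴰ β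
  neg-unique (a , b) (c , d) eq =
    cong₂ _,_ (unique a c (cong proj₁ eq)) (unique b d (cong proj₂ eq))
    where
    unique : ∀ a c → a + c ≡ 0ℤ → c ≡ - a
    unique a c a+c≡0 = begin
      c               ≡⟨ c≡a+c-a a c ⟩
      (a + c) + - a   ≡⟨ cong (_+ - a) a+c≡0 ⟩
      0ℤ + - a        ≡⟨ ℤₚ.+-identityˡ (- a) ⟩
      - a             ∎
      where
      open ≡-Reasoning
      c≡a+c-a : ∀ a c → c ≡ (a + c) + - a
      c≡a+c-a = solve-∀

  conj-* : ∀ β γ → conj (β *ᴰ γ) ≡ conj β *ᴰ conj γ
  conj-* (a , b) (c , d) = cong₂ _,_ (e₁ a b c d (+ D)) (e₂ a b c d)
    where
    e₁ : ∀ a b c d D → a * c + D * b * d ≡ a * c + D * (- b) * (- d)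
    e₁ = solve-∀
    e₂ : ∀ a b c d → - (a * d + b * c) ≡ a * (- d) + (- b) * c
    e₂ = solve-∀

  conj-- : ∀ β γ → conj (β -ᴰ γ) ≡ conj β -ᴰ conj γ
  conj-- (a , b) (c , d) = cong (a - c ,_) (e b d)
    where
    e : ∀ b d → - (b - d) ≡ - b - - d
    e = solve-∀

  ·-as-* : ∀ n β → n · β ≡ (n , 0ℤ) *ᴰ β
  ·-as-* n (a , b) = cong₂ _,_ (e₁ n a b (+ D)) (e₂ n a b)
    where
    e₁ : ∀ n a b D → n * a ≡ n * a + D * 0ℤ * b
    e₁ = solve-∀
    e₂ : ∀ n a b → n * b ≡ n * b + 0ℤ * a
    e₂ = solve-∀

  ·-*-· : ∀ m n β γ → (m · β) *ᴰ (n · γ) ≡ (m * n) · (β *ᴰ γ)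
  ·-*-· m n (a , b) (c , d) = cong₂ _,_ (e₁ m n a b c d (+ D)) (e₂ m n a b c d)
    where
    e₁ : ∀ m n a b c d D → m * a * (n * c) + D * (m * b) * (n * d) ≡ m * n * (a * c + D * b * d)
    e₁ = solve-∀
    e₂ : ∀ m n a b c d → m * a * (n * d) + m * b * (n * c) ≡ m * n * (a * d + b * c)
    e₂ = solve-∀

  ·-identityˡ : ∀ β → 1ℤ · β ≡ β
  ·-identityˡ (a , b) = cong₂ _,_ (ℤₚ.*-identityˡ a) (ℤₚ.*-identityˡ b)

  -1·-neg : ∀ β → -1ℤ · β ≡ -ᴰ β
  -1·-neg (a , b) = cong₂ _,_ (ℤₚ.-1*i≡-i a) (ℤₚ.-1*i≡-i b)

  x≡y+z⇒x-y≡z : ∀ {β γ ζ} → β ≡ γ +ᴰ ζ → β -ᴰ γ ≡ ζ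
  x≡y+z⇒x-y≡z {γ = c , d} {ζ = e , f} refl = cong₂ _,_ (e₁ c e) (e₁ d f)
    where
    e₁ : ∀ c e → c + e - c ≡ e
    e₁ = solve-∀

  x≡n·y+z⇒x-y≡[n-1]·y+z : ∀ {β n γ ζ} → β ≡ n · γ +ᴰ ζ → β -ᴰ γ ≡ (n - 1ℤ) · γ +ᴰ ζ
  x≡n·y+z⇒x-y≡[n-1]·y+z {n = n} {γ = c , d} {ζ = e , f} refl = cong₂ _,_ (e₁ n c e) (e₁ n d f)
    where
    e₁ : ∀ n c e → n * c + e - c ≡ (n - 1ℤ) * c + e
    e₁ = solve-∀

  opposite-multiples-cancel : ∀ m n κ → m · ((-1ℤ * n) · κ) +ᴰ n · ((1ℤ * m) · κ) ≡ 0ᴰ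
  opposite-multiples-cancel m n (a , b) = cong₂ _,_ (e m n a) (e m n b)
    where
    e : ∀ m n a → m * (-1ℤ * n * a) + n * (1ℤ * m * a) ≡ 0ℤ
    e = solve-∀

  three-term-identity : ∀ Γ₀ Γ₁ V Ch Cm Q₁ Q₂ → Γ₁ · (Q₁ -ᴰ Cm) +ᴰ Γ₀ · (Q₂ -ᴰ Cm) ≡ 0ᴰ →
    Γ₁ · (Ch -ᴰ V · Cm) +ᴰ Γ₁ · (Q₁ -ᴰ Ch) +ᴰ Γ₀ · Q₂ ≡ -ᴰ ((V * Γ₁ - Γ₀ - Γ₁) · Cm)
  three-term-identity Γ₀ Γ₁ V (h₁ , h₂) (c₁ , c₂) (q₁ , q₂) (r₁ , r₂) balance =
    cong₂ _,_ (component Γ₀ Γ₁ V h₁ c₁ q₁ r₁ (cong proj₁ balance)) (component Γ₀ Γ₁ V h₂ c₂ q₂ r₂ (cong proj₂ balance))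
    where
    component : ∀ Γ₀ Γ₁ V h c q r → Γ₁ * (q - c) + Γ₀ * (r - c) ≡ 0ℤ →
      Γ₁ * (h - V * c) + Γ₁ * (q - h) + Γ₀ * r ≡ - ((V * Γ₁ - Γ₀ - Γ₁) * c)
    component Γ₀ Γ₁ V h c q r bal = begin
      Γ₁ * (h - V * c) + Γ₁ * (q - h) + Γ₀ * r                ≡⟨ e Γ₀ Γ₁ V h c q r ⟩
      - ((V * Γ₁ - Γ₀ - Γ₁) * c) + (Γ₁ * (q - c) + Γ₀ * (r - c)) ≡⟨ cong (_+_ (- ((V * Γ₁ - Γ₀ - Γ₁) * c))) bal ⟩
      - ((V * Γ₁ - Γ₀ - Γ₁) * c) + 0ℤ                          ≡⟨ ℤₚ.+-identityʳ _ ⟩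
      - ((V * Γ₁ - Γ₀ - Γ₁) * c)                               ∎
      where
      open ≡-Reasoning
      e : ∀ Γ₀ Γ₁ V h c q r → Γ₁ * (h - V * c) + Γ₁ * (q - h) + Γ₀ * r
          ≡ - ((V * Γ₁ - Γ₀ - Γ₁) * c) + (Γ₁ * (q - c) + Γ₀ * (r - c))
      e = solve-∀

  module Order (nonsquare : ∀ x y → x * x ≡ + D * y * y → y ≡ 0ℤ) where

    TP : ZD → Set
    TP = TotallyPositive D

    -- β > 0 as a real number: either β ≻ 0, or β > 0 > β′, which means √D β ≻ 0.
    Positive : ZD → Set
    Positive β = TP β ⊎ TP (√D· β)

    infix 4 _<ᴰ_
    _<ᴰ_ : ZD → ZD → Set
    β <ᴰ γ = Positive (γ -ᴰ β)

    0<D : 0ℤ < + D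
    0<D = positive-if-nonsquare D (nonsquare 0ℤ 1ℤ)
      where
      positive-if-nonsquare : ∀ n → (0ℤ * 0ℤ ≡ + n * 1ℤ * 1ℤ → 1ℤ ≡ 0ℤ) → 0ℤ < + n
      positive-if-nonsquare zero    1≡0 with () ← 1≡0 refl
      positive-if-nonsquare (suc _) _   = +<+ (s≤s z≤n)

    private
      0≤D*y*y : ∀ y → 0ℤ ≤ + D * y * y
      0≤D*y*y y = subst (0ℤ ≤_) (sym (ℤₚ.*-assoc (+ D) y y)) (0≤i*j {+ D} (+≤+ z≤n) (0≤i*i y))

      neg-square : ∀ x → - x * - x ≡ x * x
      neg-square = solve-∀

      D-neg-square : ∀ D y → D * - y * - y ≡ D * y * y
      D-neg-square = solve-∀

      0<x⇒-x≮0 : ∀ {x} → 0ℤ < x → ¬ (0ℤ < - x)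
      0<x⇒-x≮0 0<x = ℤₚ.<-asym (ℤₚ.neg-mono-< 0<x)

    tp-conj : ∀ {β} → TP β → TP (conj β)
    tp-conj {a , b} (0<a , Dbb<aa) = 0<a , subst (_< a * a) (sym (D-neg-square (+ D) b)) Dbb<aa

    tp-cross : ∀ {a b c d} → TP (a , b) → TP (c , d) → + D * b * d < a * c
    tp-cross {a} {b} {c} {d} (0<a , Dbb<aa) (0<c , Ddd<cc) =
      i*i<j*j⇒i<j (0≤i*j (ℤₚ.<⇒≤ 0<a) (ℤₚ.<⇒≤ 0<c)) (begin-strict
        (+ D * b * d) * (+ D * b * d) ≡⟨ e₁ (+ D) b d ⟩
        (+ D * b * b) * (+ D * d * d) <⟨ *-mono-<-nonNeg (0≤D*y*y b) Dbb<aa (0≤D*y*y d) Ddd<cc ⟩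
        (a * a) * (c * c)             ≡⟨ e₂ a c ⟩
        (a * c) * (a * c)             ∎)
      where
      open ℤₚ.≤-Reasoning
      e₁ : ∀ D b d → (D * b * d) * (D * b * d) ≡ (D * b * b) * (D * d * d)
      e₁ = solve-∀
      e₂ : ∀ a c → (a * a) * (c * c) ≡ (a * c) * (a * c)
      e₂ = solve-∀

    tp-+ : ∀ {β γ} → TP β → TP γ → TP (β +ᴰ γ)
    tp-+ {a , b} {c , d} tpβ@(0<a , Dbb<aa) tpγ@(0<c , Ddd<cc) =
      ℤₚ.+-mono-< 0<a 0<c , (begin-strict
        + D * (b + d) * (b + d)                   ≡⟨ e₁ (+ D) b d ⟩
        (+ D * b * b + + D * d * d) + (Dbd + Dbd) <⟨ ℤₚ.+-mono-< (ℤₚ.+-mono-< Dbb<aa Ddd<cc)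
                                                                  (ℤₚ.+-mono-< Dbd<ac Dbd<ac) ⟩
        (a * a + c * c) + (a * c + a * c)         ≡⟨ e₂ a c ⟩
        (a + c) * (a + c)                         ∎)
      where
      open ℤₚ.≤-Reasoning
      Dbd : ℤ
      Dbd = + D * b * d
      Dbd<ac : Dbd < a * c
      Dbd<ac = tp-cross tpβ tpγ
      e₁ : ∀ D b d → D * (b + d) * (b + d) ≡ (D * b * b + D * d * d) + (D * b * d + D * b * d)
      e₁ = solve-∀
      e₂ : ∀ a c → (a * a + c * c) + (a * c + a * c) ≡ (a + c) * (a + c)
      e₂ = solve-∀

    tp-* : ∀ {β γ} → TP β → TP γ → TP (β *ᴰ γ)
    tp-* {a , b} {c , d} tpβ@(_ , Dbb<aa) tpγ@(_ , Ddd<cc) =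
      subst (0ℤ <_) (e₁ a b c d (+ D)) (i<j⇒0<j-i (tp-cross tpβ (tp-conj tpγ))) ,
      0<j-i⇒i<j (subst (0ℤ <_) (e₂ a b c d (+ D)) (0<i*j (i<j⇒0<j-i Dbb<aa) (i<j⇒0<j-i Ddd<cc)))
      where
      e₁ : ∀ a b c d D → a * c - D * b * - d ≡ a * c + D * b * d
      e₁ = solve-∀
      e₂ : ∀ a b c d D → (a * a - D * b * b) * (c * c - D * d * d)
                        ≡ (a * c + D * b * d) * (a * c + D * b * d) - D * (a * d + b * c) * (a * d + b * c)
      e₂ = solve-∀

    tp-cancel : ∀ {n β} → 0ℤ < n → TP (n · β) → TP β
    tp-cancel {n} {x , y} 0<n (0<nx , Dnyny<nxnx) =
      ℤₚ.*-cancelˡ-<-nonNeg n {{0≤n}} (subst (_< n * x) (sym (ℤₚ.*-zeroʳ n)) 0<nx) ,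
      ℤₚ.*-cancelˡ-<-nonNeg (n * n) {{nonNegative (0≤i*i n)}}
        (subst₂ _<_ (e₁ n y (+ D)) (e₂ n x) Dnyny<nxnx)
      where
      0≤n : ℤ.NonNegative n
      0≤n = nonNegative (ℤₚ.<⇒≤ 0<n)
      e₁ : ∀ n y D → D * (n * y) * (n * y) ≡ n * n * (D * y * y)
      e₁ = solve-∀
      e₂ : ∀ n x → n * x * (n * x) ≡ n * n * (x * x)
      e₂ = solve-∀

    private
      D*D-square : ∀ D x → D * x * x ≡ D * (x * x)
      D*D-square = solve-∀

      Dy-square : ∀ D y → D * y * (D * y) ≡ D * (D * y * y)
      Dy-square = solve-∀

    tp-√D-intro : ∀ {x y} → 0ℤ < y → x * x < + D * y * y → TP (√D· (x , y))
    tp-√D-intro {x} {y} 0<y xx<Dyy =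
      0<i*j 0<D 0<y ,
      subst₂ _<_ (sym (D*D-square (+ D) x)) (sym (Dy-square (+ D) y))
        (ℤₚ.*-monoˡ-<-pos (+ D) {{positive 0<D}} xx<Dyy)

    tp-√D-elim : ∀ {x y} → TP (√D· (x , y)) → x * x < + D * y * y
    tp-√D-elim {x} {y} (_ , DDxx<DyDy) =
      ℤₚ.*-cancelˡ-<-nonNeg (+ D) (subst₂ _<_ (D*D-square (+ D) x) (Dy-square (+ D) y) DDxx<DyDy)

    positive-asym : ∀ β → Positive β → ¬ Positive (-ᴰ β)
    positive-asym (x , y) (inj₁ (0<x , _)) (inj₁ (0<-x , _)) = 0<x⇒-x≮0 0<x 0<-x
    positive-asym (x , y) (inj₂ (0<Dy , _)) (inj₂ (0<D-y , _)) =
      0<x⇒-x≮0 0<Dy (subst (0ℤ <_) (sym (ℤₚ.neg-distribʳ-* (+ D) y)) 0<D-y)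
    positive-asym (x , y) (inj₁ (_ , Dyy<xx)) (inj₂ tp) =
      ℤₚ.<-asym Dyy<xx (subst₂ _<_ (neg-square x) (D-neg-square (+ D) y) (tp-√D-elim tp))
    positive-asym (x , y) (inj₂ tp) (inj₁ (_ , D-y-y<-x-x)) =
      ℤₚ.<-asym (tp-√D-elim tp) (subst₂ _<_ (D-neg-square (+ D) y) (neg-square x) D-y-y<-x-x)

    trichotomy : ∀ β → Positive β ⊎ β ≡ 0ᴰ ⊎ Positive (-ᴰ β)
    trichotomy (x , y) with ℤₚ.<-cmp (+ D * y * y) (x * x)
    ... | tri< Dyy<xx _ _ with ℤₚ.<-cmp 0ℤ x
    ...   | tri< 0<x _ _ = inj₁ (inj₁ (0<x , Dyy<xx))
    ...   | tri≈ _ refl _ = ⊥-elim (ℤₚ.<⇒≱ Dyy<xx (0≤D*y*y y))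
    ...   | tri> _ _ x<0 =
      inj₂ (inj₂ (inj₁ (ℤₚ.neg-mono-< x<0 , subst₂ _<_ (sym (D-neg-square (+ D) y)) (sym (neg-square x)) Dyy<xx)))
    trichotomy (x , y) | tri≈ _ xx≡Dyy _ with nonsquare x y (sym xx≡Dyy)
    ... | refl = inj₂ (inj₁ (cong (_, 0ℤ) x≡0))
      where
      x≡0 : x ≡ 0ℤ
      x≡0 with ℤₚ.i*j≡0⇒i≡0∨j≡0 x (trans (sym xx≡Dyy) (ℤₚ.*-zeroʳ (+ D * 0ℤ)))
      ... | inj₁ x≡0 = x≡0
      ... | inj₂ x≡0 = x≡0
    trichotomy (x , y) | tri> _ _ xx<Dyy with ℤₚ.<-cmp 0ℤ y
    ...   | tri< 0<y _ _ = inj₁ (inj₂ (tp-√D-intro 0<y xx<Dyy))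
    ...   | tri≈ _ refl _ = ⊥-elim (ℤₚ.<⇒≱ xx<Dyy (subst (_≤ x * x) (sym (ℤₚ.*-zeroʳ (+ D * 0ℤ))) (0≤i*i x)))
    ...   | tri> _ _ y<0 =
      inj₂ (inj₂ (inj₂ (tp-√D-intro (ℤₚ.neg-mono-< y<0) (subst₂ _<_ (sym (neg-square x)) (sym (D-neg-square (+ D) y)) xx<Dyy))))

    private
      √D-distrib-+ : ∀ β γ → √D· (β +ᴰ γ) ≡ √D· β +ᴰ √D· γ
      √D-distrib-+ (a , b) (c , d) = cong (_, a + c) (ℤₚ.*-distribˡ-+ (+ D) b d)

      cancel-right : ∀ β γ → -ᴰ (β +ᴰ γ) +ᴰ β ≡ -ᴰ γ
      cancel-right (a , b) (c , d) = cong₂ _,_ (e a c) (e b d)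
        where
        e : ∀ a c → - (a + c) + a ≡ - c
        e = solve-∀

      √D-cancel-left : ∀ β γ → √D· (-ᴰ (β +ᴰ γ)) +ᴰ √D· γ ≡ √D· (-ᴰ β)
      √D-cancel-left (a , b) (c , d) = cong₂ _,_ (e₁ (+ D) b d) (e₂ a c)
        where
        e₁ : ∀ D b d → D * - (b + d) + D * d ≡ D * - b
        e₁ = solve-∀
        e₂ : ∀ a c → - (a + c) + c ≡ - a
        e₂ = solve-∀

    -- If β + γ were not positive, adding β or √D·γ to its negative would
    -- produce a totally positive element contradicting the positivity of γ or β.
    private
      positive-+-mixed : ∀ β γ → TP β → TP (√D· γ) → Positive (β +ᴰ γ)
      positive-+-mixed β γ tpβ tp√γ with trichotomy (β +ᴰ γ)
      ... | inj₁ pos = pos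
      ... | inj₂ (inj₁ β+γ≡0) =
        ⊥-elim (positive-asym β (inj₁ tpβ) (inj₂ (subst (TP ∘ √D·_) (neg-unique β γ β+γ≡0) tp√γ)))
      ... | inj₂ (inj₂ (inj₁ tp)) =
        ⊥-elim (positive-asym γ (inj₂ tp√γ) (inj₁ (subst TP (cancel-right β γ) (tp-+ tp tpβ))))
      ... | inj₂ (inj₂ (inj₂ tp)) =
        ⊥-elim (positive-asym β (inj₁ tpβ) (inj₂ (subst TP (√D-cancel-left β γ) (tp-+ tp tp√γ))))

    positive-+ : ∀ {β γ} → Positive β → Positive γ → Positive (β +ᴰ γ)
    positive-+         (inj₁ tpβ) (inj₁ tpγ) = inj₁ (tp-+ tpβ tpγ)
    positive-+ {β} {γ} (inj₂ tpβ) (inj₂ tpγ) = inj₂ (subst TP (sym (√D-distrib-+ β γ)) (tp-+ tpβ tpγ))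
    positive-+ {β} {γ} (inj₁ tpβ) (inj₂ tpγ) = positive-+-mixed β γ tpβ tpγ
    positive-+ {β} {γ} (inj₂ tpβ) (inj₁ tpγ) = subst Positive (+ᴰ-comm γ β) (positive-+-mixed γ β tpγ tpβ)

    private
      *-√D : ∀ β γ → β *ᴰ √D· γ ≡ √D· (β *ᴰ γ)
      *-√D (a , b) (c , d) = cong₂ _,_ (e₁ a b c d (+ D)) (e₂ a b c d (+ D))
        where
        e₁ : ∀ a b c d D → a * (D * d) + D * b * c ≡ D * (a * d + b * c)
        e₁ = solve-∀
        e₂ : ∀ a b c d D → a * c + b * (D * d) ≡ a * c + D * b * d
        e₂ = solve-∀

      √D-* : ∀ β γ → √D· β *ᴰ γ ≡ √D· (β *ᴰ γ)
      √D-* (a , b) (c , d) = cong₂ _,_ (e₁ a b c d (+ D)) (e₂ a b c d (+ D))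
        where
        e₁ : ∀ a b c d D → D * b * c + D * a * d ≡ D * (a * d + b * c)
        e₁ = solve-∀
        e₂ : ∀ a b c d D → D * b * d + a * c ≡ a * c + D * b * d
        e₂ = solve-∀

      √D-*-√D : ∀ β γ → √D· β *ᴰ √D· γ ≡ + D · (β *ᴰ γ)
      √D-*-√D (a , b) (c , d) = cong₂ _,_ (e₁ a b c d (+ D)) (e₂ a b c d (+ D))
        where
        e₁ : ∀ a b c d D → D * b * (D * d) + D * a * c ≡ D * (a * c + D * b * d)
        e₁ = solve-∀
        e₂ : ∀ a b c d D → D * b * c + a * (D * d) ≡ D * (a * d + b * c)
        e₂ = solve-∀

    positive-* : ∀ {β γ} → Positive β → Positive γ → Positive (β *ᴰ γ)
    positive-*         (inj₁ tpβ) (inj₁ tpγ) = inj₁ (tp-* tpβ tpγ)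
    positive-* {β} {γ} (inj₁ tpβ) (inj₂ tpγ) = inj₂ (subst TP (*-√D β γ) (tp-* tpβ tpγ))
    positive-* {β} {γ} (inj₂ tpβ) (inj₁ tpγ) = inj₂ (subst TP (√D-* β γ) (tp-* tpβ tpγ))
    positive-* {β} {γ} (inj₂ tpβ) (inj₂ tpγ) = inj₁ (tp-cancel 0<D (subst TP (√D-*-√D β γ) (tp-* tpβ tpγ)))

    positive-· : ∀ {n β} → 0ℤ < n → Positive β → Positive (n · β)
    positive-· {n} {β} 0<n pos = subst Positive (sym (·-as-* n β)) (positive-* (inj₁ tp-n) pos)
      where
      tp-n : TP (n , 0ℤ)
      tp-n = 0<n , subst (_< n * n) (sym (ℤₚ.*-zeroʳ (+ D * 0ℤ))) (0<i*j 0<n 0<n)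

    <ᴰ-trans : ∀ {β γ ζ} → β <ᴰ γ → γ <ᴰ ζ → β <ᴰ ζ
    <ᴰ-trans {a , b} {c , d} {e , f} β<γ γ<ζ = subst Positive (cong₂ _,_ (e₁ a c e) (e₁ b d f)) (positive-+ β<γ γ<ζ)
      where
      e₁ : ∀ a c e → c - a + (e - c) ≡ e - a
      e₁ = solve-∀

    *-self-mono-<ᴰ : ∀ {β γ} → Positive β → β <ᴰ γ → β *ᴰ β <ᴰ γ *ᴰ γ
    *-self-mono-<ᴰ {β@(a , b)} {γ@(c , d)} posβ β<γ =
      subst Positive (cong₂ _,_ (e₂ a b c d (+ D)) (e₃ a b c d))
        (positive-* β<γ (subst Positive (cong₂ _,_ (e₁ a c) (e₁ b d)) (positive-+ β<γ (positive-+ posβ posβ))))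
      where
      e₁ : ∀ a c → c - a + (a + a) ≡ c + a
      e₁ = solve-∀
      e₂ : ∀ a b c d D → (c - a) * (c + a) + D * (d - b) * (d + b) ≡ (c * c + D * d * d) - (a * a + D * b * b)
      e₂ = solve-∀
      e₃ : ∀ a b c d → (c - a) * (d + b) + (d - b) * (c + a) ≡ (c * d + d * c) - (a * b + b * a)
      e₃ = solve-∀

    conj-positive : ∀ {x y} → 0ℤ < x → 0ℤ < norm (x , y) → Positive (conj (x , y))
    conj-positive {x} {y} 0<x 0<norm = inj₁ (0<x , subst (_< x * x) (sym (D-neg-square (+ D) y)) (0<j-i⇒i<j 0<norm))

    neg-conj-positive : ∀ {x y} → 0ℤ < y → norm (x , y) < 0ℤ → Positive (-ᴰ conj (x , y))
    neg-conj-positive {x} {y} 0<y norm<0 = inj₂ (tp-√D-intro (subst (0ℤ <_) (sym (ℤₚ.neg-involutive y)) 0<y)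
      (subst₂ _<_ (sym (neg-square x)) (cong (λ z → + D * z * z) (sym (ℤₚ.neg-involutive y)))
        (0<j-i⇒i<j (subst (0ℤ <_) (e x y (+ D)) (ℤₚ.neg-mono-< norm<0)))))
      where
      e : ∀ x y D → - (x * x - D * y * y) ≡ D * y * y - x * x
      e = solve-∀

module SecondOrderRecurrence (u : ℤ) where

  open import Data.Integer.Base using (_+_; _-_; _*_; -_; _≤_; _<_)
  open ℤ-Solver using (solve-∀)

  fib : ℕ → ℤ
  fib zero          = 0ℤ
  fib (suc zero)    = 1ℤ
  fib (suc (suc n)) = u * fib (suc n) + fib n

  Recurrent : (ℕ → ℤ) → Set
  Recurrent X = ∀ n → X (suc (suc n)) ≡ u * X (suc n) + X n

  fib-recurrent : Recurrent fib
  fib-recurrent n = refl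

  recurrent-suc : ∀ {X} → Recurrent X → Recurrent (X ∘ suc)
  recurrent-suc rec n = rec (suc n)

  recurrent-+ : ∀ {X Y} → Recurrent X → Recurrent Y → Recurrent (λ n → X n + Y n)
  recurrent-+ {X} {Y} recX recY n = begin
    X (suc (suc n)) + Y (suc (suc n))                    ≡⟨ cong₂ _+_ (recX n) (recY n) ⟩
    (u * X (suc n) + X n) + (u * Y (suc n) + Y n)        ≡⟨ e u (X (suc n)) (X n) (Y (suc n)) (Y n) ⟩
    u * (X (suc n) + Y (suc n)) + (X n + Y n)            ∎
    where
    open ≡-Reasoning
    e : ∀ u x₁ x₀ y₁ y₀ → (u * x₁ + x₀) + (u * y₁ + y₀) ≡ u * (x₁ + y₁) + (x₀ + y₀)
    e = solve-∀

  recurrent-*ˡ : ∀ c {X} → Recurrent X → Recurrent (λ n → c * X n)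
  recurrent-*ˡ c {X} rec n = begin
    c * X (suc (suc n))            ≡⟨ cong (c *_) (rec n) ⟩
    c * (u * X (suc n) + X n)      ≡⟨ e c u (X (suc n)) (X n) ⟩
    u * (c * X (suc n)) + c * X n  ∎
    where
    open ≡-Reasoning
    e : ∀ c u x₁ x₀ → c * (u * x₁ + x₀) ≡ u * (c * x₁) + c * x₀
    e = solve-∀

  recurrent-neg : ∀ {X} → Recurrent X → Recurrent (λ n → - X n)
  recurrent-neg {X} rec n = begin
    - X (suc (suc n))              ≡⟨ cong -_ (rec n) ⟩
    - (u * X (suc n) + X n)        ≡⟨ e u (X (suc n)) (X n) ⟩
    u * - X (suc n) + - X n        ∎
    where
    open ≡-Reasoning
    e : ∀ u x₁ x₀ → - (u * x₁ + x₀) ≡ u * - x₁ + - x₀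
    e = solve-∀

  shift-formula : ∀ {X} → Recurrent X → ∀ t → X (suc t) ≡ fib (suc t) * X 1 + fib t * X 0
  shift-formula {X} rec zero = e (X 1) (X 0)
    where
    e : ∀ x₁ x₀ → x₁ ≡ 1ℤ * x₁ + 0ℤ * x₀
    e = solve-∀
  shift-formula {X} rec (suc zero) = trans (rec 0) (e u (X 1) (X 0))
    where
    e : ∀ u x₁ x₀ → u * x₁ + x₀ ≡ (u * 1ℤ + 0ℤ) * x₁ + 1ℤ * x₀
    e = solve-∀
  shift-formula {X} rec (suc (suc t)) = begin
    X (suc (suc (suc t)))                                 ≡⟨ rec (suc t) ⟩
    u * X (suc (suc t)) + X (suc t)                       ≡⟨ cong₂ (λ p q → u * p + q) (shift-formula rec (suc t)) (shift-formula rec t) ⟩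
    u * (g₂ * X 1 + g₁ * X 0) + (g₁ * X 1 + g₀ * X 0)     ≡⟨ e u g₂ g₁ g₀ (X 1) (X 0) ⟩
    (u * g₂ + g₁) * X 1 + (u * g₁ + g₀) * X 0             ∎
    where
    open ≡-Reasoning
    g₀ g₁ g₂ : ℤ
    g₀ = fib t
    g₁ = fib (suc t)
    g₂ = fib (suc (suc t))
    e : ∀ u g₂ g₁ g₀ x₁ x₀ → u * (g₂ * x₁ + g₁ * x₀) + (g₁ * x₁ + g₀ * x₀) ≡ (u * g₂ + g₁) * x₁ + (u * g₁ + g₀) * x₀
    e = solve-∀

  fib-+ : ∀ r a → fib (suc (r ℕ.+ a)) ≡ fib (suc r) * fib (suc a) + fib r * fib a
  fib-+ r a = shift-formula (λ n → fib-recurrent (n ℕ.+ a)) r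

  module _ (0<u : 0ℤ < u) where

    fib-mono : ∀ n → fib n ≤ fib (suc n)
    0≤fib : ∀ n → 0ℤ ≤ fib n

    fib-mono zero = +≤+ z≤n
    fib-mono (suc n) = begin
      fib (suc n)              ≡⟨ ℤₚ.*-identityˡ (fib (suc n)) ⟨
      1ℤ * fib (suc n)         ≤⟨ ℤₚ.*-monoʳ-≤-nonNeg (fib (suc n)) {{nonNegative (0≤fib (suc n))}} (ℤₚ.i<j⇒suc[i]≤j 0<u) ⟩
      u * fib (suc n)          ≡⟨ ℤₚ.+-identityʳ (u * fib (suc n)) ⟨
      u * fib (suc n) + 0ℤ     ≤⟨ ℤₚ.+-monoʳ-≤ (u * fib (suc n)) (0≤fib n) ⟩
      u * fib (suc n) + fib n  ∎
      where open ℤₚ.≤-Reasoning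

    0≤fib zero    = +≤+ z≤n
    0≤fib (suc n) = ℤₚ.≤-trans (0≤fib n) (fib-mono n)

    0<fib : ∀ n → 0ℤ < fib (suc n)
    0<fib zero    = +<+ (s≤s z≤n)
    0<fib (suc n) = ℤₚ.<-≤-trans (0<fib n) (fib-mono (suc n))

  disc : (ℕ → ℤ) → ℤ
  disc X = X 0 * X 2 - X 1 * X 1

  catalan-base : ∀ {X} → Recurrent X → ∀ r → X 0 * X (r ℕ.+ r) - X r * X r ≡ fib r * fib r * disc X
  catalan-base {X} rec zero = e (X 0) (disc X)
    where
    e : ∀ x d → x * x - x * x ≡ 0ℤ * 0ℤ * d
    e = solve-∀
  catalan-base {X} rec (suc t) = begin
    X 0 * X (suc t ℕ.+ suc t) - X (suc t) * X (suc t)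
      ≡⟨ cong₂ (λ p q → X 0 * p - q * q) X-double (shift-formula rec t) ⟩
    X 0 * ((g₁ * (u * g₁ + g₀) + g₀ * g₁) * X 1 + (g₁ * g₁ + g₀ * g₀) * X 0) - (g₁ * X 1 + g₀ * X 0) * (g₁ * X 1 + g₀ * X 0)
      ≡⟨ e u g₁ g₀ (X 1) (X 0) ⟩
    g₁ * g₁ * (X 0 * (u * X 1 + X 0) - X 1 * X 1)
      ≡⟨ cong (λ p → g₁ * g₁ * (X 0 * p - X 1 * X 1)) (rec 0) ⟨
    g₁ * g₁ * disc X
      ∎
    where
    open ≡-Reasoning
    g₀ g₁ : ℤ
    g₀ = fib t
    g₁ = fib (suc t)
    X-double : X (suc t ℕ.+ suc t) ≡ (g₁ * (u * g₁ + g₀) + g₀ * g₁) * X 1 + (g₁ * g₁ + g₀ * g₀) * X 0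
    X-double = begin
      X (suc (t ℕ.+ suc t))                                        ≡⟨ shift-formula rec (t ℕ.+ suc t) ⟩
      fib (suc (t ℕ.+ suc t)) * X 1 + fib (t ℕ.+ suc t) * X 0       ≡⟨ cong₂ (λ p q → p * X 1 + q * X 0) (fib-+ t (suc t))
                                                                        (trans (cong fib (ℕₚ.+-suc t t)) (fib-+ t t)) ⟩
      (g₁ * (u * g₁ + g₀) + g₀ * g₁) * X 1 + (g₁ * g₁ + g₀ * g₀) * X 0 ∎
    e : ∀ u g₁ g₀ x₁ x₀ →
      x₀ * ((g₁ * (u * g₁ + g₀) + g₀ * g₁) * x₁ + (g₁ * g₁ + g₀ * g₀) * x₀) - (g₁ * x₁ + g₀ * x₀) * (g₁ * x₁ + g₀ * x₀)
      ≡ g₁ * g₁ * (x₀ * (u * x₁ + x₀) - x₁ * x₁)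
    e = solve-∀

  disc-alternates : ∀ {X} → Recurrent X → ∀ a → disc (λ n → X (n ℕ.+ a)) ≡ -1ℤ ^ a * disc X
  disc-alternates {X} rec zero = sym (ℤₚ.*-identityˡ (disc X))
  disc-alternates {X} rec (suc a) = begin
    X (suc a) * X (3 ℕ.+ a) - X (2 ℕ.+ a) * X (2 ℕ.+ a)    ≡⟨ cong (λ p → X (suc a) * p - X (2 ℕ.+ a) * X (2 ℕ.+ a)) (rec (suc a)) ⟩
    X (suc a) * (u * X (2 ℕ.+ a) + X (suc a)) - X (2 ℕ.+ a) * X (2 ℕ.+ a)
                                                         ≡⟨ cong (λ p → X (suc a) * (u * p + X (suc a)) - p * p) (rec a) ⟩
    X (suc a) * (u * (u * X (suc a) + X a) + X (suc a)) - (u * X (suc a) + X a) * (u * X (suc a) + X a)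
                                                         ≡⟨ e₁ u (X (suc a)) (X a) ⟩
    - (X a * (u * X (suc a) + X a) - X (suc a) * X (suc a))
                                                         ≡⟨ cong (λ p → - (X a * p - X (suc a) * X (suc a))) (rec a) ⟨
    - disc (λ n → X (n ℕ.+ a))                           ≡⟨ cong -_ (disc-alternates rec a) ⟩
    - (-1ℤ ^ a * disc X)                                 ≡⟨ e₂ (-1ℤ ^ a) (disc X) ⟩
    -1ℤ * -1ℤ ^ a * disc X                               ∎
    where
    open ≡-Reasoning
    e₁ : ∀ u x₁ x₀ → x₁ * (u * (u * x₁ + x₀) + x₁) - (u * x₁ + x₀) * (u * x₁ + x₀) ≡ - (x₀ * (u * x₁ + x₀) - x₁ * x₁)
    e₁ = solve-∀
    e₂ : ∀ s d → - (s * d) ≡ -1ℤ * s * d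
    e₂ = solve-∀

  catalan : ∀ {X} → Recurrent X → ∀ a r →
    X a * X (r ℕ.+ r ℕ.+ a) - X (r ℕ.+ a) * X (r ℕ.+ a) ≡ -1ℤ ^ a * (fib r * fib r) * disc X
  catalan {X} rec a r = begin
    X a * X (r ℕ.+ r ℕ.+ a) - X (r ℕ.+ a) * X (r ℕ.+ a)  ≡⟨ catalan-base (λ n → rec (n ℕ.+ a)) r ⟩
    fib r * fib r * disc (λ n → X (n ℕ.+ a))            ≡⟨ cong (fib r * fib r *_) (disc-alternates rec a) ⟩
    fib r * fib r * (-1ℤ ^ a * disc X)                  ≡⟨ e (fib r) (-1ℤ ^ a) (disc X) ⟩
    -1ℤ ^ a * (fib r * fib r) * disc X                  ∎
    where
    open ≡-Reasoning
    e : ∀ g s d → g * g * (s * d) ≡ s * (g * g) * d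
    e = solve-∀

module QuadraticCatalan (D : ℕ) (u : ℤ) where

  open import Data.Integer.Base using (_+_; _-_; _*_; -_)
  open ℤ-Solver using (solve-∀)
  open QuadraticIntegers D
  open SecondOrderRecurrence u
  open ≡-Reasoning

  discᴰ : (ℕ → ZD) → ZD
  discᴰ X = X 0 *ᴰ X 2 -ᴰ X 1 *ᴰ X 1

  private
    combine-real : ∀ D c pa pb pm qa qb qm p₀ p₁ p₂ q₀ q₁ q₂ →
      pa * pb - pm * pm ≡ c * (p₀ * p₂ - p₁ * p₁) →
      qa * qb - qm * qm ≡ c * (q₀ * q₂ - q₁ * q₁) →
      pa * pb + D * qa * qb - (pm * pm + D * qm * qm) ≡ c * (p₀ * p₂ + D * q₀ * q₂ - (p₁ * p₁ + D * q₁ * q₁))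
    combine-real D c pa pb pm qa qb qm p₀ p₁ p₂ q₀ q₁ q₂ hP hQ = begin
      pa * pb + D * qa * qb - (pm * pm + D * qm * qm)            ≡⟨ e₁ D pa pb pm qa qb qm ⟩
      (pa * pb - pm * pm) + D * (qa * qb - qm * qm)              ≡⟨ cong₂ (λ p q → p + D * q) hP hQ ⟩
      c * (p₀ * p₂ - p₁ * p₁) + D * (c * (q₀ * q₂ - q₁ * q₁))    ≡⟨ e₂ D c p₀ p₁ p₂ q₀ q₁ q₂ ⟩
      c * (p₀ * p₂ + D * q₀ * q₂ - (p₁ * p₁ + D * q₁ * q₁))      ∎
      where
      e₁ : ∀ D pa pb pm qa qb qm →
        pa * pb + D * qa * qb - (pm * pm + D * qm * qm) ≡ (pa * pb - pm * pm) + D * (qa * qb - qm * qm)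
      e₁ = solve-∀
      e₂ : ∀ D c p₀ p₁ p₂ q₀ q₁ q₂ →
        c * (p₀ * p₂ - p₁ * p₁) + D * (c * (q₀ * q₂ - q₁ * q₁)) ≡ c * (p₀ * p₂ + D * q₀ * q₂ - (p₁ * p₁ + D * q₁ * q₁))
      e₂ = solve-∀

    -- The mixed part is read off from the identity for P + Q by polarisation.
    combine-imag : ∀ c pa pb pm qa qb qm p₀ p₁ p₂ q₀ q₁ q₂ →
      pa * pb - pm * pm ≡ c * (p₀ * p₂ - p₁ * p₁) →
      qa * qb - qm * qm ≡ c * (q₀ * q₂ - q₁ * q₁) →
      (pa + qa) * (pb + qb) - (pm + qm) * (pm + qm) ≡ c * ((p₀ + q₀) * (p₂ + q₂) - (p₁ + q₁) * (p₁ + q₁)) →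
      pa * qb + qa * pb - (pm * qm + qm * pm) ≡ c * (p₀ * q₂ + q₀ * p₂ - (p₁ * q₁ + q₁ * p₁))
    combine-imag c pa pb pm qa qb qm p₀ p₁ p₂ q₀ q₁ q₂ hP hQ hS = begin
      pa * qb + qa * pb - (pm * qm + qm * pm)
        ≡⟨ e₁ pa pb pm qa qb qm ⟩
      ((pa + qa) * (pb + qb) - (pm + qm) * (pm + qm)) - (pa * pb - pm * pm) - (qa * qb - qm * qm)
        ≡⟨ cong₂ _-_ (cong₂ _-_ hS hP) hQ ⟩
      c * ((p₀ + q₀) * (p₂ + q₂) - (p₁ + q₁) * (p₁ + q₁)) - c * (p₀ * p₂ - p₁ * p₁) - c * (q₀ * q₂ - q₁ * q₁)
        ≡⟨ e₂ c p₀ p₁ p₂ q₀ q₁ q₂ ⟩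
      c * (p₀ * q₂ + q₀ * p₂ - (p₁ * q₁ + q₁ * p₁))
        ∎
      where
      e₁ : ∀ pa pb pm qa qb qm → pa * qb + qa * pb - (pm * qm + qm * pm)
           ≡ ((pa + qa) * (pb + qb) - (pm + qm) * (pm + qm)) - (pa * pb - pm * pm) - (qa * qb - qm * qm)
      e₁ = solve-∀
      e₂ : ∀ c p₀ p₁ p₂ q₀ q₁ q₂ →
        c * ((p₀ + q₀) * (p₂ + q₂) - (p₁ + q₁) * (p₁ + q₁)) - c * (p₀ * p₂ - p₁ * p₁) - c * (q₀ * q₂ - q₁ * q₁)
        ≡ c * (p₀ * q₂ + q₀ * p₂ - (p₁ * q₁ + q₁ * p₁))
      e₂ = solve-∀

  catalanᴰ : ∀ {X : ℕ → ZD} → Recurrent (proj₁ ∘ X) → Recurrent (proj₂ ∘ X) → ∀ a r →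
    X a *ᴰ X (r ℕ.+ r ℕ.+ a) -ᴰ X (r ℕ.+ a) *ᴰ X (r ℕ.+ a) ≡ (-1ℤ ^ a * (fib r * fib r)) · discᴰ X
  catalanᴰ {X} recP recQ a r = cong₂ _,_
    (combine-real (+ D) c (P a) (P b) (P m) (Q a) (Q b) (Q m) (P 0) (P 1) (P 2) (Q 0) (Q 1) (Q 2)
      (catalan recP a r) (catalan recQ a r))
    (combine-imag c (P a) (P b) (P m) (Q a) (Q b) (Q m) (P 0) (P 1) (P 2) (Q 0) (Q 1) (Q 2)
      (catalan recP a r) (catalan recQ a r) (catalan (recurrent-+ recP recQ) a r))
    where
    P = proj₁ ∘ X
    Q = proj₂ ∘ X
    b = r ℕ.+ r ℕ.+ a
    m = r ℕ.+ a
    c = -1ℤ ^ a * (fib r * fib r)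

module Irrationality {D k : ℕ} (k²<D : k ℕ.* k ℕ.< D) (D<[k+1]² : D ℕ.< suc k ℕ.* suc k) where

  open import Data.Nat.Base using (_+_; _*_; _∸_; _≤_; _<_)
  open ℕ-Solver using (solve-∀)
  open QuadraticIntegers D using (norm; norm-*; _*ᴰ_)

  private
    square-* : ∀ k b → k * k * (b * b) ≡ k * b * (k * b)
    square-* = solve-∀

    +-∸ : ∀ {m n} → n ≤ m → + (m ∸ n) ≡ + m ℤ.- + n
    +-∸ {m} {n} n≤m = sym (trans (ℤₚ.m-n≡m⊖n m n) (ℤₚ.⊖-≥ n≤m))

  module _ {a b : ℕ} (a²≡Db² : a * a ≡ D * (b * b)) (0<b : 0 < b) where

    k*b<a : k * b < a
    k*b<a with a ℕₚ.≤? k * b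
    ... | no a≰kb  = ℕₚ.≰⇒> a≰kb
    ... | yes a≤kb = ⊥-elim (ℕₚ.<-irrefl a²≡Db² (ℕₚ.≤-<-trans (ℕₚ.*-mono-≤ a≤kb a≤kb)
          (subst (_< D * (b * b)) (square-* k b) (ℕₚ.*-monoˡ-< (b * b) {{ℕ.>-nonZero (ℕₚ.*-mono-< 0<b 0<b)}} k²<D))))

    a<[k+1]*b : a < suc k * b
    a<[k+1]*b with suc k * b ℕₚ.≤? a
    ... | no [k+1]b≰a  = ℕₚ.≰⇒> [k+1]b≰a
    ... | yes [k+1]b≤a = ⊥-elim (ℕₚ.<-irrefl (sym a²≡Db²) (ℕₚ.<-≤-trans
          (subst (D * (b * b) <_) (square-* (suc k) b) (ℕₚ.*-monoˡ-< (b * b) {{ℕ.>-nonZero (ℕₚ.*-mono-< 0<b 0<b)}} D<[k+1]²))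
          (ℕₚ.*-mono-≤ [k+1]b≤a [k+1]b≤a)))

    k*a≤D*b : k * a ≤ D * b
    k*a≤D*b = ℕₚ.*-cancelʳ-≤ (k * a) (D * b) b {{ℕ.>-nonZero 0<b}}
      (subst₂ _≤_ (e₁ k a b) (trans a²≡Db² (e₂ D b)) (ℕₚ.*-monoˡ-≤ a (ℕₚ.<⇒≤ k*b<a)))
      where
      e₁ : ∀ k a b → k * b * a ≡ k * a * b
      e₁ = solve-∀
      e₂ : ∀ D b → D * (b * b) ≡ D * b * b
      e₂ = solve-∀

    smaller-solution : (D * b ∸ k * a) * (D * b ∸ k * a) ≡ D * ((a ∸ k * b) * (a ∸ k * b))
    smaller-solution = ℤₚ.+-injective (begin
      + (a′ * a′)                   ≡⟨ ℤₚ.pos-* a′ a′ ⟩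
      + a′ ℤ.* + a′                 ≡⟨ ℤₚ.i-j≡0⇒i≡j _ _ norm[a′,b′]≡0 ⟩
      + D ℤ.* + b′ ℤ.* + b′         ≡⟨ ℤₚ.*-assoc (+ D) (+ b′) (+ b′) ⟩
      + D ℤ.* (+ b′ ℤ.* + b′)       ≡⟨ cong (+ D ℤ.*_) (ℤₚ.pos-* b′ b′) ⟨
      + D ℤ.* + (b′ * b′)           ≡⟨ ℤₚ.pos-* D (b′ * b′) ⟨
      + (D * (b′ * b′))             ∎)
      where
      open ≡-Reasoning
      a′ b′ : ℕ
      a′ = D * b ∸ k * a
      b′ = a ∸ k * b
      γ : ZD
      γ = ℤ.- + k , 1ℤ
      norm[a,b]≡0 : norm (+ a , + b) ≡ 0ℤ
      norm[a,b]≡0 = ℤₚ.i≡j⇒i-j≡0 (begin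
        + a ℤ.* + a               ≡⟨ ℤₚ.pos-* a a ⟨
        + (a * a)                 ≡⟨ cong +_ (trans a²≡Db² (sym (ℕₚ.*-assoc D b b))) ⟩
        + (D * b * b)             ≡⟨ ℤₚ.pos-* (D * b) b ⟩
        + (D * b) ℤ.* + b         ≡⟨ cong (ℤ._* + b) (ℤₚ.pos-* D b) ⟩
        + D ℤ.* + b ℤ.* + b       ∎)
      [a′,b′]≡[a,b]*γ : (+ a′ , + b′) ≡ (+ a , + b) *ᴰ γ
      [a′,b′]≡[a,b]*γ = cong₂ _,_
        (trans (+-∸ k*a≤D*b) (trans (cong₂ ℤ._-_ (ℤₚ.pos-* D b) (ℤₚ.pos-* k a)) (e₁ (+ D) (+ k) (+ a) (+ b))))
        (trans (+-∸ (ℕₚ.<⇒≤ k*b<a)) (trans (cong (ℤ._-_ (+ a)) (ℤₚ.pos-* k b)) (e₂ (+ k) (+ a) (+ b))))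
        where
        e₁ : ∀ D k a b → D ℤ.* b ℤ.- k ℤ.* a ≡ a ℤ.* ℤ.- k ℤ.+ D ℤ.* b ℤ.* 1ℤ
        e₁ = ℤ-Solver.solve-∀
        e₂ : ∀ k a b → a ℤ.- k ℤ.* b ≡ a ℤ.* 1ℤ ℤ.+ b ℤ.* ℤ.- k
        e₂ = ℤ-Solver.solve-∀
      norm[a′,b′]≡0 : norm (+ a′ , + b′) ≡ 0ℤ
      norm[a′,b′]≡0 = begin
        norm (+ a′ , + b′)                ≡⟨ cong norm [a′,b′]≡[a,b]*γ ⟩
        norm ((+ a , + b) *ᴰ γ)           ≡⟨ norm-* (+ a , + b) γ ⟩
        norm (+ a , + b) ℤ.* norm γ       ≡⟨ cong (ℤ._* norm γ) norm[a,b]≡0 ⟩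
        0ℤ                                ∎

  -- Descent: a solution with b > 0 yields the solution (D b − k a, a − k b),
  -- whose second entry lies strictly between 0 and b since k b < a < (k + 1) b.
  no-rational-sqrt : ∀ b a → a * a ≡ D * (b * b) → b ≡ 0
  no-rational-sqrt = <-rec _ descend
    where
    descend : ∀ b → (∀ {b′} → b′ < b → ∀ a → a * a ≡ D * (b′ * b′) → b′ ≡ 0) → ∀ a → a * a ≡ D * (b * b) → b ≡ 0
    descend zero    _       _ _       = refl
    descend (suc c) smaller a a²≡Db² =
      ⊥-elim (ℕₚ.<⇒≢ (ℕₚ.m<n⇒0<n∸m kb<a) (sym (smaller b′<b (D * suc c ∸ k * a) (smaller-solution a²≡Db² (s≤s z≤n)))))
      where
      kb<a : k * suc c < a
      kb<a = k*b<a a²≡Db² (s≤s z≤n)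
      b′<b : a ∸ k * suc c < suc c
      b′<b = ℕₚ.+-cancelʳ-< (k * suc c) _ (suc c)
        (subst (_< suc c + k * suc c) (sym (ℕₚ.m∸n+n≡m (ℕₚ.<⇒≤ kb<a))) (a<[k+1]*b a²≡Db² (s≤s z≤n)))

  irrational : ∀ x y → x ℤ.* x ≡ + D ℤ.* y ℤ.* y → y ≡ 0ℤ
  irrational x y x²≡Dy² = ℤₚ.∣i∣≡0⇒i≡0 (no-rational-sqrt ∣ y ∣ ∣ x ∣ (begin
    ∣ x ∣ * ∣ x ∣               ≡⟨ ℤₚ.abs-* x x ⟨
    ∣ x ℤ.* x ∣                 ≡⟨ cong ∣_∣ x²≡Dy² ⟩
    ∣ + D ℤ.* y ℤ.* y ∣         ≡⟨ ℤₚ.abs-* (+ D ℤ.* y) y ⟩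
    ∣ + D ℤ.* y ∣ * ∣ y ∣       ≡⟨ cong (_* ∣ y ∣) (ℤₚ.abs-* (+ D) y) ⟩
    D * ∣ y ∣ * ∣ y ∣           ≡⟨ ℕₚ.*-assoc D ∣ y ∣ ∣ y ∣ ⟩
    D * (∣ y ∣ * ∣ y ∣)         ∎))
    where open ≡-Reasoning

module _ where

  open import Data.Nat.Base using (_+_; _*_; _≤_; _<_)

  div-lower : ∀ x d → 0 < d → d * (x div d) ≤ x
  div-lower x (suc d) _ = subst (_≤ x) (ℕₚ.*-comm (x / suc d) (suc d)) (m/n*n≤m x (suc d))

  div-upper : ∀ x d → 0 < d → x < d * suc (x div d)
  div-upper x (suc d) _ = begin-strict
    x                              ≡⟨ m≡m%n+[m/n]*n x (suc d) ⟩
    x % suc d + x / suc d * suc d  <⟨ ℕₚ.+-monoˡ-< _ (m%n<n x (suc d)) ⟩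
    suc d + x / suc d * suc d      ≡⟨ cong (λ z → suc d + z) (ℕₚ.*-comm (x / suc d) (suc d)) ⟩
    suc d + suc d * (x / suc d)    ≡⟨ ℕₚ.*-suc (suc d) _ ⟨
    suc d * suc (x / suc d)        ∎
    where open ℕₚ.≤-Reasoning

  div-exact : ∀ x d → 0 < d → d ∣ x → d * (x div d) ≡ x
  div-exact x (suc d) _ d∣x = m*[n/m]≡n d∣x

module ContinuedFraction (D : ℕ) where

  open import Data.Nat.Base using (_+_; _*_; _∸_; _≤_; _<_)
  open ℕ-Solver using (solve-∀)

  k : ℕ
  k = floorSqrt D

  m d a : ℕ → ℕ
  m n = proj₁ (cfState D n)
  d n = proj₁ (proj₂ (cfState D n))
  a = cfSqrt D

  -- The complete quotients (√D + m n) / d n have integral part a n.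
  record Invariant (n : ℕ) : Set where
    field
      0<d     : 0 < d n
      m≤k     : m n ≤ k
      d∣D∸m²  : d n ∣ D ∸ m n * m n
      a-lower : d n * a n ≤ k + m n
      a-upper : k + m n < d n * suc (a n)

  invariant-zero : Invariant 0
  invariant-zero = record
    { 0<d     = s≤s z≤n
    ; m≤k     = z≤n
    ; d∣D∸m²  = 1∣ _
    ; a-lower = subst (_≤ k + 0) (sym (ℕₚ.*-identityˡ k)) (ℕₚ.m≤m+n k 0)
    ; a-upper = subst₂ _<_ (sym (ℕₚ.+-identityʳ k)) (sym (ℕₚ.*-identityˡ (suc k))) (ℕₚ.n<1+n k)
    }

  module Step (k²<D : k * k < D) (2≤a : ∀ n → 2 ≤ a n) (n : ℕ) (inv : Invariant n) where

    open Invariant inv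
    open ℕₚ.≤-Reasoning

    d≤k : d n ≤ k
    d≤k = ℕₚ.*-cancelˡ-≤ 2 (begin
      2 * d n        ≡⟨ ℕₚ.*-comm 2 (d n) ⟩
      d n * 2        ≤⟨ ℕₚ.*-monoʳ-≤ (d n) (2≤a n) ⟩
      d n * a n      ≤⟨ a-lower ⟩
      k + m n        ≤⟨ ℕₚ.+-monoʳ-≤ k m≤k ⟩
      k + k          ≡⟨ cong (λ z → k + z) (ℕₚ.+-identityʳ k) ⟨
      k + (k + 0)    ∎)

    m<d*a : m n < d n * a n
    m<d*a = ℕₚ.+-cancelˡ-< k (m n) (d n * a n) (begin-strict
      k + m n          <⟨ a-upper ⟩
      d n * suc (a n)  ≡⟨ ℕₚ.*-suc (d n) (a n) ⟩
      d n + d n * a n  ≤⟨ ℕₚ.+-monoˡ-≤ (d n * a n) d≤k ⟩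
      k + d n * a n    ∎)

    m-recurrence : m (suc n) + m n ≡ d n * a n
    m-recurrence = ℕₚ.m∸n+n≡m (ℕₚ.<⇒≤ m<d*a)

    m′≤k : m (suc n) ≤ k
    m′≤k = ℕₚ.+-cancelʳ-≤ (m n) (m (suc n)) k (subst (_≤ k + m n) (sym m-recurrence) a-lower)

    m′²<D : m (suc n) * m (suc n) < D
    m′²<D = ℕₚ.≤-<-trans (ℕₚ.*-mono-≤ m′≤k m′≤k) k²<D

    -- (D − m′²) + m′ (m′ + m) = (D − m²) + m (m′ + m), and m′ + m = d a.
    d∣D∸m′² : d n ∣ D ∸ m (suc n) * m (suc n)
    d∣D∸m′² = ∣m+n∣m⇒∣n (subst (d n ∣_) (sym balance) (∣m∣n⇒∣m+n d∣D∸m² (∣n⇒∣m*n (m n) (m∣m*n (a n)))))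
                        (∣n⇒∣m*n (m (suc n)) (m∣m*n (a n)))
      where
      m′ X Y : ℕ
      m′ = m (suc n)
      X = D ∸ m′ * m′
      Y = D ∸ m n * m n
      e : ∀ X Y p q → X + p * p ≡ Y + q * q → p * (p + q) + X ≡ Y + q * (p + q)
      e X Y p q h = trans (e₁ X p q) (trans (cong (_+ p * q) h) (e₂ Y p q))
        where
        e₁ : ∀ X p q → p * (p + q) + X ≡ (X + p * p) + p * q
        e₁ = solve-∀
        e₂ : ∀ Y p q → (Y + q * q) + p * q ≡ Y + q * (p + q)
        e₂ = solve-∀
      balance : m′ * (d n * a n) + X ≡ Y + m n * (d n * a n)
      balance = subst (λ z → m′ * z + X ≡ Y + m n * z) m-recurrence
        (e X Y m′ (m n) (trans (ℕₚ.m∸n+n≡m (ℕₚ.<⇒≤ m′²<D))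
                               (sym (ℕₚ.m∸n+n≡m (ℕₚ.≤-trans (ℕₚ.*-mono-≤ m≤k m≤k) (ℕₚ.<⇒≤ k²<D))))))

    d′-exact : d n * d (suc n) ≡ D ∸ m (suc n) * m (suc n)
    d′-exact = div-exact _ (d n) 0<d d∣D∸m′²

    d-recurrence : d (suc n) * d n + m (suc n) * m (suc n) ≡ D
    d-recurrence = trans (cong (_+ m (suc n) * m (suc n)) (trans (ℕₚ.*-comm (d (suc n)) (d n)) d′-exact))
                         (ℕₚ.m∸n+n≡m (ℕₚ.<⇒≤ m′²<D))

    0<d′ : 0 < d (suc n)
    0<d′ = ℕₚ.n≢0⇒n>0 λ d′≡0 → ℕₚ.<⇒≢ (ℕₚ.m<n⇒0<n∸m m′²<D)
      (sym (trans (sym d′-exact) (trans (cong (d n *_) d′≡0) (ℕₚ.*-zeroʳ (d n)))))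

    invariant-suc : Invariant (suc n)
    invariant-suc = record
      { 0<d     = 0<d′
      ; m≤k     = m′≤k
      ; d∣D∸m²  = divides (d n) (sym d′-exact)
      ; a-lower = div-lower (k + m (suc n)) (d (suc n)) 0<d′
      ; a-upper = div-upper (k + m (suc n)) (d (suc n)) 0<d′
      }

  module _ (k²<D : k * k < D) (2≤a : ∀ n → 2 ≤ a n) where

    invariant : ∀ n → Invariant n
    invariant zero    = invariant-zero
    invariant (suc n) = Step.invariant-suc k²<D 2≤a n (invariant n)

    m-recurrence : ∀ n → m (suc n) + m n ≡ d n * a n
    m-recurrence n = Step.m-recurrence k²<D 2≤a n (invariant n)

    d-recurrence : ∀ n → d (suc n) * d n + m (suc n) * m (suc n) ≡ D
    d-recurrence n = Step.d-recurrence k²<D 2≤a n (invariant n)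

module ConvergentNorms (D : ℕ) (k²<D : floorSqrt D ℕ.* floorSqrt D ℕ.< D) (2≤a : ∀ n → 2 ℕ.≤ cfSqrt D n) where

  open import Data.Integer.Base using (_+_; _-_; _*_; -_; _<_)
  open ℤ-Solver using (solve-∀)
  open ContinuedFraction D
  open QuadraticIntegers D using (norm)
  open ≡-Reasoning

  P Q P₋ Q₋ : ℕ → ℤ
  P n  = + conv-p a n
  Q n  = + conv-q a n
  P₋ n = + proj₁ (proj₁ (pqPair a n))
  Q₋ n = + proj₁ (proj₂ (pqPair a n))

  sign : ℕ → ℤ
  sign n = -1ℤ ^ suc n

  record NormIdentities (n : ℕ) : Set where
    field
      current  : norm (P n , Q n) ≡ sign n * + d (suc n)
      mixed    : P n * P₋ n - + D * Q n * Q₋ n ≡ - (sign n * + m (suc n))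
      previous : norm (P₋ n , Q₋ n) ≡ - (sign n * + d n)

  private
    +-*-+ : ∀ x y z → + (x ℕ.* y ℕ.+ z) ≡ + x * + y + + z
    +-*-+ x y z = trans (ℤₚ.pos-+ (x ℕ.* y) z) (cong (_+ + z) (ℤₚ.pos-* x y))

    m-recurrenceℤ : ∀ n → + m (suc n) ≡ + d n * + a n - + m n
    m-recurrenceℤ n = begin
      + m (suc n)                    ≡⟨ e (+ m (suc n)) (+ m n) ⟩
      (+ m (suc n) + + m n) - + m n  ≡⟨ cong (_- + m n) (ℤₚ.pos-+ (m (suc n)) (m n)) ⟨
      + (m (suc n) ℕ.+ m n) - + m n  ≡⟨ cong (λ z → + z - + m n) (m-recurrence k²<D 2≤a n) ⟩
      + (d n ℕ.* a n) - + m n        ≡⟨ cong (_- + m n) (ℤₚ.pos-* (d n) (a n)) ⟩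
      + d n * + a n - + m n          ∎
      where
      e : ∀ x y → x ≡ (x + y) - y
      e = solve-∀

    d-recurrenceℤ : ∀ n → + d (suc n) * + d n + + m (suc n) * + m (suc n) ≡ + D
    d-recurrenceℤ n = begin
      + d (suc n) * + d n + + m (suc n) * + m (suc n)
        ≡⟨ cong₂ _+_ (ℤₚ.pos-* (d (suc n)) (d n)) (ℤₚ.pos-* (m (suc n)) (m (suc n))) ⟨
      + (d (suc n) ℕ.* d n) + + (m (suc n) ℕ.* m (suc n))
        ≡⟨ ℤₚ.pos-+ (d (suc n) ℕ.* d n) (m (suc n) ℕ.* m (suc n)) ⟨
      + (d (suc n) ℕ.* d n ℕ.+ m (suc n) ℕ.* m (suc n))
        ≡⟨ cong +_ (d-recurrence k²<D 2≤a n) ⟩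
      + D ∎

    -- d₂ d₁ = D − m₂² = d₁ d₀ + m₁² − (d₁ a₁ − m₁)², then cancel d₁ > 0.
    d-step : ∀ n → + d (2 ℕ.+ n) ≡ + d n + + 2 * + a (suc n) * + m (suc n) - + a (suc n) * + a (suc n) * + d (suc n)
    d-step n = ℤₚ.*-cancelʳ-≡ _ _ (+ d (suc n)) {{>-nonZero (+<+ (Invariant.0<d (invariant k²<D 2≤a (suc n))))}} (begin
      d₂ * d₁                              ≡⟨ e₁ d₂ d₁ m₂ ⟩
      (d₂ * d₁ + m₂ * m₂) - m₂ * m₂        ≡⟨ cong (_- m₂ * m₂) (trans (d-recurrenceℤ (suc n)) (sym (d-recurrenceℤ n))) ⟩
      (d₁ * d₀ + m₁ * m₁) - m₂ * m₂        ≡⟨ cong (λ z → (d₁ * d₀ + m₁ * m₁) - z * z) (m-recurrenceℤ (suc n)) ⟩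
      (d₁ * d₀ + m₁ * m₁) - (d₁ * A - m₁) * (d₁ * A - m₁) ≡⟨ e₂ d₀ d₁ m₁ A ⟩
      (d₀ + + 2 * A * m₁ - A * A * d₁) * d₁ ∎)
      where
      d₀ d₁ d₂ m₁ m₂ A : ℤ
      d₀ = + d n
      d₁ = + d (suc n)
      d₂ = + d (2 ℕ.+ n)
      m₁ = + m (suc n)
      m₂ = + m (2 ℕ.+ n)
      A = + a (suc n)
      e₁ : ∀ x y z → x * y ≡ (x * y + z * z) - z * z
      e₁ = solve-∀
      e₂ : ∀ d₀ d₁ m₁ A → (d₁ * d₀ + m₁ * m₁) - (d₁ * A - m₁) * (d₁ * A - m₁) ≡ (d₀ + + 2 * A * m₁ - A * A * d₁) * d₁
      e₂ = solve-∀

  private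
    m₁≡k : + m 1 ≡ + k
    m₁≡k = trans (m-recurrenceℤ 0) (e (+ k))
      where
      e : ∀ k → 1ℤ * k - 0ℤ ≡ k
      e = solve-∀

    norm-identities-zero : NormIdentities 0
    norm-identities-zero = record
      { current  = begin
          + k * + k - + D * 1ℤ * 1ℤ                         ≡⟨ cong (λ z → + k * + k - z * 1ℤ * 1ℤ) (d-recurrenceℤ 0) ⟨
          + k * + k - (+ d 1 * 1ℤ + + m 1 * + m 1) * 1ℤ * 1ℤ  ≡⟨ cong (λ z → + k * + k - (+ d 1 * 1ℤ + z * z) * 1ℤ * 1ℤ) m₁≡k ⟩
          + k * + k - (+ d 1 * 1ℤ + + k * + k) * 1ℤ * 1ℤ      ≡⟨ e₁ (+ k) (+ d 1) ⟩
          sign 0 * + d 1                                     ∎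
      ; mixed    = trans (e₂ (+ k) (+ D)) (cong (λ z → - (sign 0 * z)) (sym m₁≡k))
      ; previous = e₃ (+ D)
      }
      where
      e₁ : ∀ k d → k * k - (d * 1ℤ + k * k) * 1ℤ * 1ℤ ≡ -1ℤ * 1ℤ * d
      e₁ = solve-∀
      e₂ : ∀ k D → k * 1ℤ - D * 1ℤ * 0ℤ ≡ - (-1ℤ * 1ℤ * k)
      e₂ = solve-∀
      e₃ : ∀ D → 1ℤ * 1ℤ - D * 0ℤ * 0ℤ ≡ - (-1ℤ * 1ℤ * 1ℤ)
      e₃ = solve-∀

    module NormStep (n : ℕ) (ids : NormIdentities n) where

      open NormIdentities ids

      A s d₁ m₁ : ℤ
      A = + a (suc n)
      s = sign n
      d₁ = + d (suc n)
      m₁ = + m (suc n)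

      P-step : P (suc n) ≡ A * P n + P₋ n
      P-step = +-*-+ (a (suc n)) (conv-p a n) _

      Q-step : Q (suc n) ≡ A * Q n + Q₋ n
      Q-step = +-*-+ (a (suc n)) (conv-q a n) _

      current-suc : norm (P (suc n) , Q (suc n)) ≡ sign (suc n) * + d (2 ℕ.+ n)
      current-suc = begin
        norm (P (suc n) , Q (suc n))
          ≡⟨ cong₂ (λ p q → p * p - + D * q * q) P-step Q-step ⟩
        (A * P n + P₋ n) * (A * P n + P₋ n) - + D * (A * Q n + Q₋ n) * (A * Q n + Q₋ n)
          ≡⟨ e₁ A (P n) (P₋ n) (Q n) (Q₋ n) (+ D) ⟩
        A * A * norm (P n , Q n) + + 2 * A * (P n * P₋ n - + D * Q n * Q₋ n) + norm (P₋ n , Q₋ n)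
          ≡⟨ cong₃ (λ x y z → A * A * x + + 2 * A * y + z) current mixed previous ⟩
        A * A * (s * d₁) + + 2 * A * - (s * m₁) + - (s * + d n)
          ≡⟨ e₂ A s (+ d n) d₁ m₁ ⟩
        -1ℤ * s * (+ d n + + 2 * A * m₁ - A * A * d₁)
          ≡⟨ cong (-1ℤ * s *_) (d-step n) ⟨
        sign (suc n) * + d (2 ℕ.+ n) ∎
        where
        e₁ : ∀ A p p₋ q q₋ D → (A * p + p₋) * (A * p + p₋) - D * (A * q + q₋) * (A * q + q₋)
             ≡ A * A * (p * p - D * q * q) + + 2 * A * (p * p₋ - D * q * q₋) + (p₋ * p₋ - D * q₋ * q₋)
        e₁ = solve-∀
        e₂ : ∀ A s d₀ d₁ m₁ → A * A * (s * d₁) + + 2 * A * - (s * m₁) + - (s * d₀) ≡ -1ℤ * s * (d₀ + + 2 * A * m₁ - A * A * d₁)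
        e₂ = solve-∀

      mixed-suc : P (suc n) * P n - + D * Q (suc n) * Q n ≡ - (sign (suc n) * + m (2 ℕ.+ n))
      mixed-suc = begin
        P (suc n) * P n - + D * Q (suc n) * Q n
          ≡⟨ cong₂ (λ p q → p * P n - + D * q * Q n) P-step Q-step ⟩
        (A * P n + P₋ n) * P n - + D * (A * Q n + Q₋ n) * Q n
          ≡⟨ e₁ A (P n) (P₋ n) (Q n) (Q₋ n) (+ D) ⟩
        A * norm (P n , Q n) + (P n * P₋ n - + D * Q n * Q₋ n)
          ≡⟨ cong₂ (λ x y → A * x + y) current mixed ⟩
        A * (s * d₁) + - (s * m₁)
          ≡⟨ e₂ A s d₁ m₁ ⟩
        - (-1ℤ * s * (d₁ * A - m₁))
          ≡⟨ cong (λ z → - (-1ℤ * s * z)) (m-recurrenceℤ (suc n)) ⟨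
        - (sign (suc n) * + m (2 ℕ.+ n)) ∎
        where
        e₁ : ∀ A p p₋ q q₋ D → (A * p + p₋) * p - D * (A * q + q₋) * q ≡ A * (p * p - D * q * q) + (p * p₋ - D * q * q₋)
        e₁ = solve-∀
        e₂ : ∀ A s d₁ m₁ → A * (s * d₁) + - (s * m₁) ≡ - (-1ℤ * s * (d₁ * A - m₁))
        e₂ = solve-∀

    norm-identities-suc : ∀ n → NormIdentities n → NormIdentities (suc n)
    norm-identities-suc n ids = record
      { current  = current-suc
      ; mixed    = mixed-suc
      ; previous = trans (NormIdentities.current ids) (e (sign n) (+ d (suc n)))
      }
      where
      open NormStep n ids
      e : ∀ s d → s * d ≡ - (-1ℤ * s * d)
      e = solve-∀

  norm-identities : ∀ n → NormIdentities n
  norm-identities zero    = norm-identities-zero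
  norm-identities (suc n) = norm-identities-suc n (norm-identities n)

  norm-convergent : ∀ n → norm (P n , Q n) ≡ sign n * + d (suc n)
  norm-convergent n = NormIdentities.current (norm-identities n)

module _ where

  open import Data.Nat.Base using (_+_; _*_; _≤_; _<_)

  periodSeq-period : ∀ k u ℓ n → n < ℓ → periodSeq k u ℓ (suc n) ≡ u
  periodSeq-period k u ℓ n n<ℓ rewrite m<n⇒m%n≡m {n = suc ℓ} (ℕₚ.m≤n⇒m≤1+n n<ℓ)
    with n ℕ.<ᵇ ℓ | ℕₚ.<⇒<ᵇ n<ℓ
  ... | true | _ = refl

  periodSeq-≥2 : ∀ k u ℓ → 2 ≤ u → u ≤ k → ∀ n → 2 ≤ periodSeq k u ℓ n
  periodSeq-≥2 k u ℓ 2≤u u≤k zero = ℕₚ.≤-trans 2≤u u≤k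
  periodSeq-≥2 k u ℓ 2≤u u≤k (suc n) with (n % suc ℓ) ℕ.<ᵇ ℓ
  ... | true  = 2≤u
  ... | false = ℕₚ.≤-trans 2≤u (ℕₚ.≤-trans u≤k (ℕₚ.m≤m+n k (k + 0)))

  step-mono : ∀ (f : ℕ → ℕ) → (∀ n → f n ≤ f (suc n)) → ∀ {m n} → m ≤ n → f m ≤ f n
  step-mono f step m≤n = go (ℕₚ.≤⇒≤′ m≤n)
    where
    go : ∀ {m n} → m ≤′ n → f m ≤ f n
    go ≤′-refl        = ℕₚ.≤-refl
    go (≤′-step m≤′n) = ℕₚ.≤-trans (go m≤′n) (step _)

  module _ (a : ℕ → ℕ) (1≤a : ∀ n → 1 ≤ a (suc n)) where

    private
      m≤a*m+r : ∀ n m r → m ≤ a (suc n) * m + r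
      m≤a*m+r n m r = ℕₚ.≤-trans (ℕₚ.m≤n*m m (a (suc n)) {{ℕ.>-nonZero (1≤a n)}}) (ℕₚ.m≤m+n _ r)

    conv-p-mono : ∀ {m n} → m ≤ n → conv-p a m ≤ conv-p a n
    conv-p-mono = step-mono (conv-p a) (λ n → m≤a*m+r n (conv-p a n) _)

    conv-q-mono : ∀ {m n} → m ≤ n → conv-q a m ≤ conv-q a n
    conv-q-mono = step-mono (conv-q a) (λ n → m≤a*m+r n (conv-q a n) _)

module RepeatedQuotient (D k u ℓ : ℕ) (k²<D : k ℕ.* k ℕ.< D) (D<[k+1]² : D ℕ.< suc k ℕ.* suc k)
               (5≤u : 5 ℕ.≤ u) (u<k : u ℕ.< k) (quotients : ∀ n → cfSqrt D n ≡ periodSeq k u ℓ n) where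

  open import Data.Integer.Base using (_+_; _-_; _*_; -_; _≤_; _<_)
  open ℤ-Solver using (solve-∀)
  open QuadraticIntegers D
  open Order (Irrationality.irrational {D} {k} k²<D D<[k+1]²)
  open SecondOrderRecurrence (+ u)
  open QuadraticCatalan D (+ u)

  a : ℕ → ℕ
  a = cfSqrt D

  private
    2≤a : ∀ n → 2 ℕ.≤ a n
    2≤a n = subst (2 ℕ.≤_) (sym (quotients n)) (periodSeq-≥2 k u ℓ (ℕₚ.≤-trans (s≤s (s≤s z≤n)) 5≤u) (ℕₚ.<⇒≤ u<k) n)

    ⌊√D⌋²<D : floorSqrt D ℕ.* floorSqrt D ℕ.< D
    ⌊√D⌋²<D = subst (λ z → z ℕ.* z ℕ.< D) (sym (quotients 0)) k²<D

    pos-*-+ : ∀ x y z → + (x ℕ.* y ℕ.+ z) ≡ + x * + y + + z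
    pos-*-+ x y z = trans (ℤₚ.pos-+ (x ℕ.* y) z) (cong (_+ + z) (ℤₚ.pos-* x y))

    0<u : 0ℤ < + u
    0<u = +<+ (ℕₚ.≤-trans (s≤s z≤n) 5≤u)

  open ContinuedFraction D using (d; invariant)
  open ConvergentNorms D ⌊√D⌋²<D 2≤a using (sign; norm-convergent)

  -- Closed forms of α_n and α′_n, valid while the partial quotients are u;
  -- δ n = |α′_n|.
  P : ℕ → ℤ
  P n = + k * fib (suc n) + fib n

  α α′ δ : ℕ → ZD
  α n  = P n , fib (suc n)
  α′ n = conj (α n)
  δ n  = sign n · α′ n

  P-recurrent : Recurrent P
  P-recurrent = recurrent-+ (recurrent-*ˡ (+ k) (recurrent-suc fib-recurrent)) fib-recurrent

  Q′-recurrent : Recurrent (λ n → - fib (suc n))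
  Q′-recurrent = recurrent-neg (recurrent-suc fib-recurrent)

  private
    alpha≡α-zero : alpha D 0 ≡ α 0
    alpha≡α-zero = cong₂ _,_ (trans (cong +_ (quotients 0)) (e (+ k))) refl
      where
      e : ∀ k → k ≡ k * 1ℤ + 0ℤ
      e = solve-∀

    alpha≡α-two : ∀ n → suc n ℕ.≤ ℓ → alpha D n ≡ α n × alpha D (suc n) ≡ α (suc n)
    alpha≡α-two zero 1≤ℓ =
      alpha≡α-zero ,
      cong₂ _,_ (trans (pos-*-+ (a 1) (a 0) 1) (trans (cong₂ (λ x y → + x * + y + 1ℤ) a₁≡u (quotients 0)) (e₁ (+ u) (+ k))))
                (trans (pos-*-+ (a 1) 1 0) (cong (λ x → + x * 1ℤ + 0ℤ) a₁≡u))
      where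
      a₁≡u : a 1 ≡ u
      a₁≡u = trans (quotients 1) (periodSeq-period k u ℓ 0 1≤ℓ)
      e₁ : ∀ u k → u * k + 1ℤ ≡ k * (u * 1ℤ + 0ℤ) + 1ℤ
      e₁ = solve-∀
    alpha≡α-two (suc n) 2+n≤ℓ with alpha≡α-two n (ℕₚ.<⇒≤ 2+n≤ℓ)
    ... | eq₀ , eq₁ = eq₁ , cong₂ _,_
      (trans (pos-*-+ (a (2 ℕ.+ n)) (conv-p a (suc n)) _)
        (trans (cong₃ (λ x y z → + x * y + z) a₂≡u (cong proj₁ eq₁) (cong proj₁ eq₀)) (sym (P-recurrent n))))
      (trans (pos-*-+ (a (2 ℕ.+ n)) (conv-q a (suc n)) _)
        (cong₃ (λ x y z → + x * y + z) a₂≡u (cong proj₂ eq₁) (cong proj₂ eq₀)))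
      where
      a₂≡u : a (2 ℕ.+ n) ≡ u
      a₂≡u = trans (quotients (2 ℕ.+ n)) (periodSeq-period k u ℓ (suc n) 2+n≤ℓ)

  alpha≡α : ∀ {n} → n ℕ.≤ ℓ → alpha D n ≡ α n
  alpha≡α {zero}  _   = alpha≡α-zero
  alpha≡α {suc n} n<ℓ = proj₂ (alpha≡α-two n n<ℓ)

  norm-α : ∀ {n} → n ℕ.≤ ℓ → norm (α n) ≡ sign n * + d (suc n)
  norm-α {n} n≤ℓ = trans (cong norm (sym (alpha≡α n≤ℓ))) (norm-convergent n)

  private
    0<d : ∀ n → 0ℤ < + d n
    0<d n = +<+ (ContinuedFraction.Invariant.0<d (invariant ⌊√D⌋²<D 2≤a n))

    0<P : ∀ n → 0ℤ < P n
    0<P n = ℤₚ.<-≤-trans (0<i*j (+<+ (ℕₚ.≤-trans (s≤s z≤n) u<k)) (0<fib 0<u n))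
                         (ℤₚ.i≤i+j _ (fib n) {{nonNegative (0≤fib 0<u n)}})

  δ-positive : ∀ {n} → n ℕ.≤ ℓ → Positive (δ n)
  δ-positive {n} n≤ℓ with -1^-cases (suc n)
  ... | inj₁ sign≡1 = subst Positive (trans (sym (·-identityˡ (α′ n))) (cong (_· α′ n) (sym sign≡1)))
          (conj-positive (0<P n) (subst (0ℤ <_) (sym norm≡d) (0<d (suc n))))
    where
    norm≡d : norm (α n) ≡ + d (suc n)
    norm≡d = trans (norm-α n≤ℓ) (trans (cong (_* + d (suc n)) sign≡1) (ℤₚ.*-identityˡ _))
  ... | inj₂ sign≡-1 = subst Positive (trans (sym (-1·-neg (α′ n))) (cong (_· α′ n) (sym sign≡-1)))
          (neg-conj-positive (0<fib 0<u n) (subst (_< 0ℤ) (sym norm≡-d) (ℤₚ.neg-mono-< (0<d (suc n)))))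
    where
    norm≡-d : norm (α n) ≡ - + d (suc n)
    norm≡-d = trans (norm-α n≤ℓ) (trans (cong (_* + d (suc n)) sign≡-1) (ℤₚ.-1*i≡-i _))

  private
    signed-recurrence : ∀ {X} → Recurrent X → ∀ s n → s * X n ≡ + u * (-1ℤ * s * X (suc n)) + -1ℤ * (-1ℤ * s) * X (suc (suc n))
    signed-recurrence {X} rec s n = trans (e (+ u) s (X (suc n)) (X n)) (cong (λ z → + u * (-1ℤ * s * X (suc n)) + -1ℤ * (-1ℤ * s) * z) (sym (rec n)))
      where
      e : ∀ u s x₁ x₀ → s * x₀ ≡ u * (-1ℤ * s * x₁) + -1ℤ * (-1ℤ * s) * (u * x₁ + x₀)
      e = solve-∀

  δ-recurrence : ∀ n → δ n ≡ + u · δ (suc n) +ᴰ δ (suc (suc n))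
  δ-recurrence n = cong₂ _,_ (signed-recurrence P-recurrent (sign n) n) (signed-recurrence Q′-recurrent (sign n) n)

  uδ<δ : ∀ n → 2 ℕ.+ n ℕ.≤ ℓ → + u · δ (suc n) <ᴰ δ n
  uδ<δ n 2+n≤ℓ = subst Positive (sym (x≡y+z⇒x-y≡z {γ = + u · δ (suc n)} {ζ = δ (suc (suc n))} (δ-recurrence n))) (δ-positive 2+n≤ℓ)

  δ-decreasing : ∀ n → 2 ℕ.+ n ℕ.≤ ℓ → δ (suc n) <ᴰ δ n
  δ-decreasing n 2+n≤ℓ = subst Positive (sym (x≡n·y+z⇒x-y≡[n-1]·y+z {n = + u} {γ = δ (suc n)} {ζ = δ (suc (suc n))} (δ-recurrence n)))
    (positive-+ (positive-· (i<j⇒0<j-i (+<+ (ℕₚ.≤-trans (s≤s (s≤s z≤n)) 5≤u))) (δ-positive (ℕₚ.<⇒≤ 2+n≤ℓ)))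
                (δ-positive 2+n≤ℓ))

  uδ<δ-far : ∀ t h → 2 ℕ.+ (t ℕ.+ h) ℕ.≤ ℓ → + u · δ (suc (t ℕ.+ h)) <ᴰ δ h
  uδ<δ-far zero    h bound = uδ<δ h bound
  uδ<δ-far (suc t) h bound = <ᴰ-trans {+ u · δ (suc (suc (t ℕ.+ h)))} {δ (suc h)} {δ h}
    (subst (λ z → + u · δ (suc z) <ᴰ δ (suc h)) (ℕₚ.+-suc t h) (uδ<δ-far t (suc h) (subst (λ z → 2 ℕ.+ z ℕ.≤ ℓ) (sym (ℕₚ.+-suc t h)) bound)))
    (δ-decreasing h (ℕₚ.≤-trans (s≤s (s≤s (ℕₚ.m≤n+m h (suc t)))) bound))

  private
    disc-α-rational : proj₁ (discᴰ α) ≡ + k * + k + + D - + u * + k - 1ℤ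
    disc-α-rational = e (+ k) (+ u) (+ D)
      where
      e : ∀ k u D → (k * 1ℤ + 0ℤ) * (k * (u * (u * 1ℤ + 0ℤ) + 1ℤ) + (u * 1ℤ + 0ℤ)) + D * 1ℤ * (u * (u * 1ℤ + 0ℤ) + 1ℤ)
                    - ((k * (u * 1ℤ + 0ℤ) + 1ℤ) * (k * (u * 1ℤ + 0ℤ) + 1ℤ) + D * (u * 1ℤ + 0ℤ) * (u * 1ℤ + 0ℤ))
                    ≡ k * k + D - u * k - 1ℤ
      e = solve-∀

    0≤disc-α-rational : 0ℤ ≤ + k * + k + + D - + u * + k - 1ℤ
    0≤disc-α-rational = subst (0ℤ ≤_) (sym (trans (e (+ k) (+ u) (+ D)) (cong₂ (λ x y → x - y + + D) (sym (ℤₚ.pos-* k k)) (sym (pos-*-+ u k 1)))))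
      (ℤₚ.+-mono-≤ (ℤₚ.i≤j⇒0≤j-i (+≤+ uk+1≤kk)) (+≤+ z≤n))
      where
      e : ∀ k u D → k * k + D - u * k - 1ℤ ≡ (k * k - (u * k + 1ℤ)) + D
      e = solve-∀
      uk+1≤kk : u ℕ.* k ℕ.+ 1 ℕ.≤ k ℕ.* k
      uk+1≤kk = ℕₚ.≤-trans (ℕₚ.+-monoʳ-≤ (u ℕ.* k) (ℕₚ.≤-trans (s≤s z≤n) u<k))
                  (subst (ℕ._≤ k ℕ.* k) (ℕₚ.+-comm k (u ℕ.* k)) (ℕₚ.*-monoˡ-≤ k u<k))

    rational-part-mono : ∀ {m n} → m ℕ.≤ n → proj₁ (alpha D m *ᴰ alpha D m) ≤ proj₁ (alpha D n *ᴰ alpha D n)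
    rational-part-mono {m} {n} m≤n = ℤₚ.+-mono-≤
      (*-self-mono-≤ (+≤+ z≤n) (+≤+ (conv-p-mono a 1≤a m≤n)))
      (subst₂ _≤_ (sym (ℤₚ.*-assoc (+ D) _ _)) (sym (ℤₚ.*-assoc (+ D) _ _))
        (ℤₚ.*-monoˡ-≤-nonNeg (+ D) (*-self-mono-≤ (+≤+ z≤n) (+≤+ (conv-q-mono a 1≤a m≤n)))))
      where
      1≤a : ∀ n → 1 ℕ.≤ a (suc n)
      1≤a n = ℕₚ.≤-trans (s≤s z≤n) (2≤a (suc n))

  private
    sign² : ∀ n → sign n * sign n ≡ 1ℤ
    sign² n with -1^-cases (suc n)
    ... | inj₁ e rewrite e = refl
    ... | inj₂ e rewrite e = refl

    δ-*-δ : ∀ m n → sign m * sign n ≡ 1ℤ → δ m *ᴰ δ n ≡ α′ m *ᴰ α′ n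
    δ-*-δ m n e = trans (·-*-· (sign m) (sign n) (α′ m) (α′ n)) (trans (cong (_· (α′ m *ᴰ α′ n)) e) (·-identityˡ _))

    conj-alpha : ∀ {n} → n ℕ.≤ ℓ → conj (alpha D n) ≡ α′ n
    conj-alpha n≤ℓ = cong conj (alpha≡α n≤ℓ)

  -- i = 1 + 2x is odd, j = i + 2r and m = i + r = (i + j) / 2, with r = 1 + t.
  module OddIndices (x t : ℕ) (j<ℓ : suc (suc t ℕ.+ suc t ℕ.+ suc (x ℕ.* 2)) ℕ.≤ ℓ) where

    i r j m : ℕ
    i = suc (x ℕ.* 2)
    r = suc t
    j = r ℕ.+ r ℕ.+ i
    m = r ℕ.+ i

    Γ₀ Γ₁ : ℤ
    Γ₀ = fib r * fib r
    Γ₁ = fib (suc r) * fib (suc r)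

    Cm Q₁ Q₂ : ZD
    Cm = α′ m *ᴰ α′ m
    Q₁ = α′ i *ᴰ α′ j
    Q₂ = α′ (x ℕ.* 2) *ᴰ α′ (suc r ℕ.+ suc r ℕ.+ x ℕ.* 2)

    private
      m≤j : m ℕ.≤ j
      m≤j = subst (m ℕ.≤_) (sym (ℕₚ.+-assoc r r i)) (ℕₚ.m≤n+m m r)

      j≤ℓ : j ℕ.≤ ℓ
      j≤ℓ = ℕₚ.<⇒≤ j<ℓ

      m≤ℓ : m ℕ.≤ ℓ
      m≤ℓ = ℕₚ.≤-trans m≤j j≤ℓ

      i≤ℓ : i ℕ.≤ ℓ
      i≤ℓ = ℕₚ.≤-trans (ℕₚ.m≤n+m i r) m≤ℓ

      j+1-even : suc r ℕ.+ suc r ℕ.+ x ℕ.* 2 ≡ (suc r ℕ.+ x) ℕ.* 2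
      j+1-even = e r x
        where
        e : ∀ r x → suc r ℕ.+ suc r ℕ.+ x ℕ.* 2 ≡ (suc r ℕ.+ x) ℕ.* 2
        e = ℕ-Solver.solve-∀

      j+1≤ℓ : suc r ℕ.+ suc r ℕ.+ x ℕ.* 2 ℕ.≤ ℓ
      j+1≤ℓ = subst (ℕ._≤ ℓ) (sym (e r x)) j<ℓ
        where
        e : ∀ r x → suc r ℕ.+ suc r ℕ.+ x ℕ.* 2 ≡ suc (r ℕ.+ r ℕ.+ suc (x ℕ.* 2))
        e = ℕ-Solver.solve-∀

    -- Case h ≥ m: already the rational parts are in the wrong order.
    rational-part-obstruction : ∀ h → m ℕ.≤ h → ¬ TP (alpha D i *ᴰ alpha D j -ᴰ alpha D h *ᴰ alpha D h)
    rational-part-obstruction h m≤h (0<difference , _) = ℤₚ.<⇒≱ (0<j-i⇒i<j 0<difference) ij≤hh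
      where
      K′ : ℤ
      K′ = + k * + k + + D - + u * + k - 1ℤ
      ij-mm≡ : proj₁ (alpha D i *ᴰ alpha D j -ᴰ alpha D m *ᴰ alpha D m) ≡ - (Γ₀ * K′)
      ij-mm≡ = begin
        proj₁ (alpha D i *ᴰ alpha D j -ᴰ alpha D m *ᴰ alpha D m)
          ≡⟨ cong₃ (λ β γ ζ → proj₁ (β *ᴰ γ -ᴰ ζ *ᴰ ζ)) (alpha≡α i≤ℓ) (alpha≡α j≤ℓ) (alpha≡α m≤ℓ) ⟩
        proj₁ (α i *ᴰ α j -ᴰ α m *ᴰ α m)
          ≡⟨ cong proj₁ (catalanᴰ P-recurrent (recurrent-suc fib-recurrent) i r) ⟩
        -1ℤ ^ i * Γ₀ * proj₁ (discᴰ α)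
          ≡⟨ cong₂ (λ s κ → s * Γ₀ * κ) (-1^odd x) disc-α-rational ⟩
        -1ℤ * Γ₀ * K′
          ≡⟨ e Γ₀ K′ ⟩
        - (Γ₀ * K′) ∎
        where
        open ≡-Reasoning
        e : ∀ Γ κ → -1ℤ * Γ * κ ≡ - (Γ * κ)
        e = solve-∀
      ij-mm≤0 : proj₁ (alpha D i *ᴰ alpha D j -ᴰ alpha D m *ᴰ alpha D m) ≤ 0ℤ
      ij-mm≤0 = subst (_≤ 0ℤ) (sym ij-mm≡) (ℤₚ.neg-mono-≤ (0≤i*j (0≤i*i (fib r)) 0≤disc-α-rational))
      ij≤hh : proj₁ (alpha D i *ᴰ alpha D j) ≤ proj₁ (alpha D h *ᴰ alpha D h)
      ij≤hh = ℤₚ.≤-trans (ℤₚ.i-j≤0⇒i≤j ij-mm≤0) (rational-part-mono m≤h)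

    catalan-balance : Γ₁ · (Q₁ -ᴰ Cm) +ᴰ Γ₀ · (Q₂ -ᴰ Cm) ≡ 0ᴰ
    catalan-balance = trans (cong₂ (λ p q → Γ₁ · p +ᴰ Γ₀ · q) catalan-i catalan-i-1) (opposite-multiples-cancel Γ₁ Γ₀ (discᴰ α′))
      where
      catalan-i : Q₁ -ᴰ Cm ≡ (-1ℤ * Γ₀) · discᴰ α′
      catalan-i = trans (catalanᴰ P-recurrent Q′-recurrent i r) (cong (λ s → (s * Γ₀) · discᴰ α′) (-1^odd x))
      catalan-i-1 : Q₂ -ᴰ Cm ≡ (1ℤ * Γ₁) · discᴰ α′
      catalan-i-1 = trans (cong (λ z → Q₂ -ᴰ α′ z *ᴰ α′ z) (ℕₚ.+-suc r (x ℕ.* 2)))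
        (trans (catalanᴰ P-recurrent Q′-recurrent (x ℕ.* 2) (suc r)) (cong (λ s → (s * Γ₁) · discᴰ α′) (-1^even x)))

    Q₂-positive : Positive Q₂
    Q₂-positive = subst Positive (δ-*-δ (x ℕ.* 2) (suc r ℕ.+ suc r ℕ.+ x ℕ.* 2) (cong₂ _*_ (-1^odd x) sign-j+1))
      (positive-* (δ-positive (ℕₚ.≤-trans (ℕₚ.n≤1+n _) i≤ℓ)) (δ-positive j+1≤ℓ))
      where
      sign-j+1 : sign (suc r ℕ.+ suc r ℕ.+ x ℕ.* 2) ≡ -1ℤ
      sign-j+1 = trans (cong (λ z → -1ℤ ^ suc z) j+1-even) (-1^odd (suc r ℕ.+ x))

    Cm-positive : Positive Cm
    Cm-positive = subst Positive (δ-*-δ m m (sign² m)) (positive-* (δ-positive m≤ℓ) (δ-positive m≤ℓ))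

    0<Γ₀ : 0ℤ < Γ₀
    0<Γ₀ = 0<i*j (0<fib 0<u t) (0<fib 0<u t)

    0<Γ₁ : 0ℤ < Γ₁
    0<Γ₁ = 0<i*j (0<fib 0<u r) (0<fib 0<u r)

    0<excess : 0ℤ < + u * + u * Γ₁ - Γ₀ - Γ₁
    0<excess = subst (0ℤ <_) (sym (split (+ u) Γ₀ Γ₁))
      (ℤₚ.+-mono-<-≤ (0<i*j (i<j⇒0<j-i 2<u²) 0<Γ₁) (ℤₚ.i≤j⇒0≤j-i (*-self-mono-≤ (0≤fib 0<u r) (fib-mono 0<u r))))
      where
      split : ∀ U Γ₀ Γ₁ → U * U * Γ₁ - Γ₀ - Γ₁ ≡ (U * U - + 2) * Γ₁ + (Γ₁ - Γ₀)
      split = solve-∀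
      2<u² : + 2 < + u * + u
      2<u² = subst (+ 2 <_) (ℤₚ.pos-* u u) (+<+ (ℕₚ.≤-trans (s≤s (s≤s (s≤s z≤n))) (ℕₚ.*-mono-≤ 5≤u 5≤u)))

    conjugate-gap : ∀ h → h ℕ.< m → Positive (α′ h *ᴰ α′ h -ᴰ (+ u * + u) · Cm)
    conjugate-gap h h<m = subst Positive
      (cong₂ _-ᴰ_ (δ-*-δ h h (sign² h)) (trans (·-*-· (+ u) (+ u) (δ m) (δ m)) (cong ((+ u * + u) ·_) (δ-*-δ m m (sign² m)))))
      (*-self-mono-<ᴰ {+ u · δ m} {δ h} (positive-· 0<u (δ-positive m≤ℓ)) uδm<δh)
      where
      t′ : ℕ
      t′ = m ℕ.∸ suc h
      1+t′+h≡m : suc (t′ ℕ.+ h) ≡ m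
      1+t′+h≡m = trans (sym (ℕₚ.+-suc t′ h)) (ℕₚ.m∸n+n≡m h<m)
      uδm<δh : + u · δ m <ᴰ δ h
      uδm<δh = subst (λ z → + u · δ z <ᴰ δ h) 1+t′+h≡m
        (uδ<δ-far t′ h (subst (λ z → suc z ℕ.≤ ℓ) (sym 1+t′+h≡m) (ℕₚ.≤-trans (s≤s m≤j) j<ℓ)))

    conjugate-hypothesis : ∀ h → h ℕ.< m → TP (alpha D i *ᴰ alpha D j -ᴰ alpha D h *ᴰ alpha D h) → Positive (Q₁ -ᴰ α′ h *ᴰ α′ h)
    conjugate-hypothesis h h<m tp = inj₁ (subst TP conj-difference tp′)
      where
      tp′ : TP (conj (alpha D i *ᴰ alpha D j -ᴰ alpha D h *ᴰ alpha D h))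
      tp′ = tp-conj tp
      h≤ℓ : h ℕ.≤ ℓ
      h≤ℓ = ℕₚ.≤-trans (ℕₚ.<⇒≤ h<m) m≤ℓ
      conj-difference : conj (alpha D i *ᴰ alpha D j -ᴰ alpha D h *ᴰ alpha D h) ≡ Q₁ -ᴰ α′ h *ᴰ α′ h
      conj-difference = trans (conj-- (alpha D i *ᴰ alpha D j) (alpha D h *ᴰ alpha D h)) (cong₂ _-ᴰ_
        (trans (conj-* (alpha D i) (alpha D j)) (cong₂ _*ᴰ_ (conj-alpha i≤ℓ) (conj-alpha j≤ℓ)))
        (trans (conj-* (alpha D h) (alpha D h)) (cong₂ _*ᴰ_ (conj-alpha h≤ℓ) (conj-alpha h≤ℓ))))

    -- Case h < m.  The Catalan identities at (i, r) and (i − 1, r + 1) balance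
    -- Γ₁ α′_i α′_j + Γ₀ α′_{i−1} α′_{j+1} against (Γ₀ + Γ₁) α′_m², whereas
    -- α′_i α′_j > α′_h² > u² α′_m².
    irrational-part-obstruction : ∀ h → h ℕ.< m → ¬ TP (alpha D i *ᴰ alpha D j -ᴰ alpha D h *ᴰ alpha D h)
    irrational-part-obstruction h h<m tp = positive-asym (excess · Cm) (positive-· 0<excess Cm-positive)
      (subst Positive (three-term-identity Γ₀ Γ₁ (+ u * + u) (α′ h *ᴰ α′ h) Cm Q₁ Q₂ catalan-balance)
        (positive-+ (positive-+ (positive-· 0<Γ₁ (conjugate-gap h h<m)) (positive-· 0<Γ₁ (conjugate-hypothesis h h<m tp)))
                    (positive-· 0<Γ₀ Q₂-positive)))
      where
      excess : ℤ
      excess = + u * + u * Γ₁ - Γ₀ - Γ₁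

  not-above-square : ∀ x t h → let i = suc (x ℕ.* 2) ; j = suc t ℕ.+ suc t ℕ.+ i in
    suc j ℕ.≤ ℓ → ¬ TP (alpha D i *ᴰ alpha D j -ᴰ alpha D h *ᴰ alpha D h)
  not-above-square x t h j<ℓ with suc t ℕ.+ suc (x ℕ.* 2) ℕₚ.≤? h
  ... | yes m≤h = OddIndices.rational-part-obstruction x t j<ℓ h m≤h
  ... | no m≰h  = OddIndices.irrational-part-obstruction x t j<ℓ h (ℕₚ.≰⇒> m≰h)

open import Data.Nat using (ℕ; _+_; _*_; _<_; _≤_; _%_)
open import Data.Nat.Base using (_∸_)
open ℕ-Solver using (solve-∀)

odd-form : ∀ i → i % 2 ≡ 1 → i ≡ suc (i / 2 * 2)
odd-form i i%2≡1 = trans (m≡m%n+[m/n]*n i 2) (cong (_+ i / 2 * 2) i%2≡1)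

private
  if-does : ∀ {P : Set} (dec : Dec P) {x y} (C : ℕ → Set) → (P → C x) → (¬ P → C y) → C (if does dec then x else y)
  if-does (yes p) C f g = f p
  if-does (no ¬p) C f g = g ¬p

floorSqrt-lower : ∀ n → floorSqrt n * floorSqrt n ≤ n
floorSqrt-lower zero    = z≤n
floorSqrt-lower (suc n) = if-does (suc r * suc r ℕₚ.≤? suc n) (λ z → z * z ≤ suc n) (λ p → p) (λ _ → ℕₚ.m≤n⇒m≤1+n (floorSqrt-lower n))
  where
  r : ℕ
  r = floorSqrt n

floorSqrt-upper : ∀ n → n < suc (floorSqrt n) * suc (floorSqrt n)
floorSqrt-upper zero    = s≤s z≤n
floorSqrt-upper (suc n) = if-does (suc r * suc r ℕₚ.≤? suc n) (λ z → suc n < suc z * suc z)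
  (λ _ → ℕₚ.≤-<-trans (floorSqrt-upper n) (ℕₚ.*-mono-< (ℕₚ.n<1+n (suc r)) (ℕₚ.n<1+n (suc r))))
  ℕₚ.≰⇒>
  where
  r : ℕ
  r = floorSqrt n

odd-pair : ∀ {i j} → i % 2 ≡ 1 → j % 2 ≡ 1 → i < j → ∃₂ λ x t → i ≡ suc (x * 2) × j ≡ suc t + suc t + suc (x * 2)
odd-pair {i} {j} i-odd j-odd i<j = x , t , i≡ , trans j≡ (trans (cong (λ z → suc (z * 2)) y≡) (e t x))
  where
  x y t : ℕ
  x = i / 2
  y = j / 2
  i≡ : i ≡ suc (x * 2)
  i≡ = odd-form i i-odd
  j≡ : j ≡ suc (y * 2)
  j≡ = odd-form j j-odd
  x<y : x < y
  x<y = ℕₚ.*-cancelʳ-< 2 x y (ℕₚ.≤-pred (subst₂ _<_ i≡ j≡ i<j))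
  t = y ∸ suc x
  y≡ : y ≡ suc t + x
  y≡ = sym (trans (sym (ℕₚ.+-suc t x)) (ℕₚ.m∸n+n≡m x<y))
  e : ∀ t x → suc ((suc t + x) * 2) ≡ suc t + suc t + suc (x * 2)
  e = solve-∀

squarefree-not-square : ∀ {D k} → Squarefree D → 2 ≤ k → k * k ≢ D
squarefree-not-square {D} {k} squarefree 2≤k k²≡D =
  ℕₚ.<⇒≢ 2≤k (sym (squarefree k (divides 1 (trans (sym k²≡D) (sym (ℕₚ.*-identityˡ (k * k)))))))

lemma4p5 : (D k u ℓ : ℕ) → 0 < D → Squarefree D → (D % 4 ≡ 2 ⊎ D % 4 ≡ 3)
    → 5 ≤ u → u < k → 1 ≤ ℓ
    → (∀ n → cfSqrt D n ≡ periodSeq k u ℓ n)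
    → (i j : ℕ) → i % 2 ≡ 1 → j % 2 ≡ 1 → i < j → 2 * j + 4 ≤ ℓ
    → ¬ (∃ λ h → mulD D (alpha D i) (alpha D j) ≻[ D ] mulD D (alpha D h) (alpha D h))
lemma4p5 D k u ℓ _ squarefree _ 5≤u u<k _ quotients i j i-odd j-odd i<j 2j+4≤ℓ (h , tp)
  with odd-pair i-odd j-odd i<j
... | x , t , refl , refl = RepeatedQuotient.not-above-square D k u ℓ k²<D D<[k+1]² 5≤u u<k quotients x t h j<ℓ tp
  where
  ⌊√D⌋≡k : floorSqrt D ≡ k
  ⌊√D⌋≡k = quotients 0
  k²<D : k * k < D
  k²<D = ℕₚ.≤∧≢⇒< (subst (λ z → z * z ≤ D) ⌊√D⌋≡k (floorSqrt-lower D))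
                  (squarefree-not-square squarefree (ℕₚ.≤-trans (s≤s (s≤s z≤n)) (ℕₚ.<⇒≤ (ℕₚ.≤-<-trans 5≤u u<k))))
  D<[k+1]² : D < suc k * suc k
  D<[k+1]² = subst (λ z → D < suc z * suc z) ⌊√D⌋≡k (floorSqrt-upper D)
  j<ℓ : suc j ≤ ℓ
  j<ℓ = ℕₚ.≤-trans (ℕₚ.m≤n+m (suc j) (j + 3)) (subst (_≤ ℓ) (e j) 2j+4≤ℓ)
    where
    e : ∀ j → 2 * j + 4 ≡ j + 3 + suc j
    e = solve-∀
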